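{- Let $a_n=\left(1+\frac{1}{\sqrt{2}}\right)^n+\left(1-\frac{1}{\sqrt{2}}\right)^n$ for $n\ge0$. Then for every integer $n\ge0$, \[ \sum_{k=0}^{n} (-1)^{k+1} \binom{8n+4}{8k+4} a_{4k+2}\,B_{8n-8k} = (2n+1) (-1)^{n+1}a_{4n+2}. \]
   Context: $B_m$ denotes the $m$-th Bernoulli number, defined by $\frac{t}{e^t-1}=\sum_{m\ge0}B_m\frac{t^m}{m!}$. -}

module Defs where

open import Data.Nat as ℕ using (ℕ; zero; suc)
open import Data.Nat.Combinatorics using (_C_)
open import Data.Integer using (+_)
open import Data.Rational as ℚ using (ℚ; 0ℚ; 1ℚ; ½; _/_)
open import Data.List using (List; []; _∷_; _++_; map; foldr; upTo; length)

ℕtoℚ : ℕ → ℚ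
ℕtoℚ n = + n / 1

sumℚ : List ℚ → ℚ
sumℚ = foldr ℚ._+_ 0ℚ

Σ0to : ℕ → (ℕ → ℚ) → ℚ
Σ0to n f = sumℚ (map f (upTo (suc n)))

at : List ℚ → ℕ → ℚ
at [] _ = 0ℚ
at (x ∷ xs) zero = x
at (x ∷ xs) (suc k) = at xs k

-- Bernoulli numbers via the standard recurrence equivalent to
-- t/(e^t-1) = Σ B_m t^m/m! :  B_0 = 1,  Σ_{k=0}^{m} C(m+1,k) B_k = 0 (m ≥ 1).
-- Given the list [B_0,…,B_{m-1}], compute B_m.
bernNext : ℕ → List ℚ → ℚ
bernNext zero _ = 1ℚ
bernNext (suc m) bs =
  ℚ.- ((+ 1 / suc (suc m)) ℚ.* sumℚ (map (λ k → ℕtoℚ (suc (suc m) C k) ℚ.* at bs k) (upTo (suc m))))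

bernTable : ℕ → List ℚ
bernTable zero = []
bernTable (suc m) = bernTable m ++ (bernNext m (bernTable m) ∷ [])

B : ℕ → ℚ
B m = bernNext m (bernTable m)

record ℚ√2 : Set where
  constructor _+_√2
  field
    re : ℚ
    ir : ℚ

infixl 6 _⊕_
infixl 7 _⊗_

_⊕_ : ℚ√2 → ℚ√2 → ℚ√2
(a + b √2) ⊕ (c + d √2) = (a ℚ.+ c) + (b ℚ.+ d) √2

_⊗_ : ℚ√2 → ℚ√2 → ℚ√2
(a + b √2) ⊗ (c + d √2) =
  (a ℚ.* c ℚ.+ ℕtoℚ 2 ℚ.* (b ℚ.* d)) + (a ℚ.* d ℚ.+ b ℚ.* c) √2

ι : ℚ → ℚ√2
ι a = a + 0ℚ √2

_^_ : ℚ√2 → ℕ → ℚ√2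
x ^ zero = ι 1ℚ
x ^ suc n = x ⊗ (x ^ n)

inv√2 : ℚ√2
inv√2 = 0ℚ + ½ √2

neg : ℚ√2 → ℚ√2
neg (a + b √2) = (ℚ.- a) + (ℚ.- b) √2

a : ℕ → ℚ√2
a n = ((ι 1ℚ ⊕ inv√2) ^ n) ⊕ ((ι 1ℚ ⊕ neg inv√2) ^ n)

sgn : ℕ → ℚ
sgn zero = 1ℚ
sgn (suc k) = ℚ.- sgn k

Σ√0to : ℕ → (ℕ → ℚ√2) → ℚ√2
Σ√0to n f = foldr _⊕_ (ι 0ℚ) (map f (upTo (suc n)))

-- Work in ℚ(ζ) for a primitive 8th root of unity ζ, where √2 = ζ − ζ³ and a_m = Xᵐ + Yᵐ with
-- X, Y = 1 ± 1/√2.  Let ω range over the sixteen points (±1 ± ζ ± ζ² ± ζ³)/2, χ(ω) be the product of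
-- the four signs, σ(j) = Σ χ(ω) ωʲ, and L(ρ) = Σ χ(ω) ρᴺ B_N(ω/ρ) for N = 8n + 4.
-- Multiplication by ζ permutes the points and flips χ, so ζʲσ(j) = −σ(j) and σ(j) vanishes unless
-- j ≡ 4 (mod 8); expanding B_N then shows that L(ρ) takes one and the same value T for all eight
-- 8th roots of unity ρ, namely T = Σ_k C(N, 8k+4) B_{8n−8k} σ(8k+4).  On the other hand flipping the
-- i-th sign of a point moves ω by ζⁱ, so pairing L(ζⁱ) with L(−ζⁱ) and using B_N(x+1) − B_N(x) = N x^(N−1)
-- gives 8T = Σ_{i<4} (L(ζⁱ) + L(−ζⁱ)) = 2N σ(N).  Finally χω⁴ takes the values κX² and κY² (κ = −ζ²)
-- eight times each, so σ(8k+4) = 8κ(−1)ᵏ a_{4k+2}, and cancelling 64κ leaves the identity.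

module Submission where

open import Algebra.Bundles using (CommutativeRing)
open import Algebra.Consequences.Propositional using (comm∧idˡ⇒id; comm∧invˡ⇒inv; comm∧distrʳ⇒distrˡ)
open import Data.Bool using (Bool; true; false; not)
open import Data.Fin as Fin using (Fin; toℕ)
import Data.Fin.Permutation as Perm
open import Data.Fin.Patterns using (0F; 1F; 2F; 3F; 4F)
import Data.Fin.Properties as Fin
open import Data.Integer using (+_)
import Data.Integer as ℤ
open import Data.Integer.Tactic.RingSolver using () renaming (solve-∀ to ℤ-solve-∀)
open import Data.List using ([]; _∷_; _++_; length; map; foldr; upTo; applyUpTo)
import Data.List.Properties as List
open import Data.Nat as ℕ using (ℕ; zero; suc; _+_; _*_; _∸_; _≤_; _<_; _!)
open import Data.Nat.Combinatorics using (_C_; nCn≡1; nC1≡n; nCk≡nC[n∸k]; k>n⇒nCk≡0; k![n∸k]!∣n!)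
open import Data.Nat.Combinatorics.Specification using (nCk≡n!/k![n-k]!)
open import Data.Nat.DivMod using (m/n*n≡m)
import Data.Nat.Properties as ℕ
open import Data.Nat.Properties using (_!≢0; _!*_!≢0)
open import Data.Nat.Tactic.RingSolver using () renaming (solve-∀ to ℕ-solve-∀)
open import Data.Product using (∃; _×_; _,_)
open import Data.Rational as ℚ using (ℚ; 0ℚ; 1ℚ; ½)
import Data.Rational.Properties as ℚ
import Data.Rational.Unnormalised as ℚᵘ
import Data.Rational.Unnormalised.Properties as ℚᵘ
open import Data.Sum using (inj₁; inj₂)
open import Data.Vec.Functional using (removeAt)
open import Defs renaming (_^_ to _^√2_)
open import Function using (_∘_)
open import Level using (0ℓ)
open import Relation.Binary.PropositionalEquality
open import Relation.Nullary using (Dec; contradiction)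
open import Relation.Nullary.Decidable using (map′; _×-dec_; from-yes; dec⇒maybe)
import Tactic.RingSolver.Core.AlmostCommutativeRing as ACR
open import Tactic.RingSolver using (solve-∀; solve)

open ≡-Reasoning

[1+n]C[n]≡1+n : ∀ n → suc n C n ≡ suc n
[1+n]C[n]≡1+n n = trans (nCk≡nC[n∸k] (ℕ.n≤1+n n)) (trans (cong (suc n C_) (ℕ.m+n∸n≡m 1 n)) (nC1≡n (suc n)))

C-factorials : ∀ {n k} → k ≤ n → (n C k) * (k ! * (n ∸ k) !) ≡ n !
C-factorials {n} {k} k≤n = trans (cong (_* (k ! * (n ∸ k) !)) (nCk≡n!/k![n-k]! k≤n)) (m/n*n≡m (k![n∸k]!∣n! k≤n))
  where instance _ = k !* (n ∸ k) !≢0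

C-trinomial : ∀ {N i j} → j ≤ i → i ≤ N → (N C i) * (i C j) ≡ (N C j) * ((N ∸ j) C (N ∸ i))
C-trinomial {N} {i} {j} j≤i i≤N = ℕ.*-cancelʳ-≡ _ _ (j ! * (i ∸ j) ! * (N ∸ i) !) (trans lhs (sym rhs))
  where
  instance
    _ = ℕ.m*n≢0 (j ! * (i ∸ j) !) ((N ∸ i) !) {{ℕ.m*n≢0 (j !) ((i ∸ j) !) {{j !≢0}} {{(i ∸ j) !≢0}}}} {{(N ∸ i) !≢0}}
  regroupₗ : ∀ a b c d e → a * b * (c * d * e) ≡ a * (b * (c * d)) * e
  regroupₗ = ℕ-solve-∀
  regroupᵣ : ∀ a b c d e → a * b * (c * d * e) ≡ a * (c * (b * (e * d)))
  regroupᵣ = ℕ-solve-∀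
  lhs : (N C i) * (i C j) * (j ! * (i ∸ j) ! * (N ∸ i) !) ≡ N !
  lhs = begin
    (N C i) * (i C j) * (j ! * (i ∸ j) ! * (N ∸ i) !)   ≡⟨ regroupₗ (N C i) (i C j) (j !) ((i ∸ j) !) ((N ∸ i) !) ⟩
    (N C i) * ((i C j) * (j ! * (i ∸ j) !)) * (N ∸ i) ! ≡⟨ cong (λ x → (N C i) * x * (N ∸ i) !) (C-factorials j≤i) ⟩
    (N C i) * i ! * (N ∸ i) !                           ≡⟨ ℕ.*-assoc (N C i) (i !) _ ⟩
    (N C i) * (i ! * (N ∸ i) !)                         ≡⟨ C-factorials i≤N ⟩
    N !                                                 ∎
  [N∸j]∸[N∸i]≡i∸j : N ∸ j ∸ (N ∸ i) ≡ i ∸ j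
  [N∸j]∸[N∸i]≡i∸j = begin
    N ∸ j ∸ (N ∸ i)   ≡⟨ ℕ.∸-+-assoc N j (N ∸ i) ⟩
    N ∸ (j + (N ∸ i)) ≡⟨ cong (N ∸_) (ℕ.+-comm j (N ∸ i)) ⟩
    N ∸ (N ∸ i + j)   ≡⟨ sym (ℕ.∸-+-assoc N (N ∸ i) j) ⟩
    N ∸ (N ∸ i) ∸ j   ≡⟨ cong (_∸ j) (ℕ.m∸[m∸n]≡n i≤N) ⟩
    i ∸ j             ∎
  rhs : (N C j) * ((N ∸ j) C (N ∸ i)) * (j ! * (i ∸ j) ! * (N ∸ i) !) ≡ N !
  rhs = begin
    (N C j) * ((N ∸ j) C (N ∸ i)) * (j ! * (i ∸ j) ! * (N ∸ i) !)
      ≡⟨ regroupᵣ (N C j) ((N ∸ j) C (N ∸ i)) (j !) ((i ∸ j) !) ((N ∸ i) !) ⟩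
    (N C j) * (j ! * (((N ∸ j) C (N ∸ i)) * ((N ∸ i) ! * (i ∸ j) !)))
      ≡⟨ cong (λ x → (N C j) * (j ! * (((N ∸ j) C (N ∸ i)) * ((N ∸ i) ! * x !)))) (sym [N∸j]∸[N∸i]≡i∸j) ⟩
    (N C j) * (j ! * (((N ∸ j) C (N ∸ i)) * ((N ∸ i) ! * (N ∸ j ∸ (N ∸ i)) !)))
      ≡⟨ cong (λ x → (N C j) * (j ! * x)) (C-factorials (ℕ.∸-monoʳ-≤ N j≤i)) ⟩
    (N C j) * (j ! * (N ∸ j) !)
      ≡⟨ C-factorials (ℕ.≤-trans j≤i i≤N) ⟩
    N ! ∎

ℚ-ring : ACR.AlmostCommutativeRing 0ℓ 0ℓ
ℚ-ring = ACR.fromCommutativeRing ℚ.+-*-commutativeRing (λ q → dec⇒maybe (0ℚ ℚ.≟ q))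

-- ℚ(ζ) for a primitive 8th root of unity ζ, i.e. ℚ[ζ]/(ζ⁴ + 1), in the basis 1, ζ, ζ², ζ³.
data ℚ[ζ] : Set where
  mk : ℚ → ℚ → ℚ → ℚ → ℚ[ζ]

infixl 6 _+ᶻ_
infixl 7 _*ᶻ_
infix  8 -ᶻ_

_+ᶻ_ : ℚ[ζ] → ℚ[ζ] → ℚ[ζ]
mk a₀ a₁ a₂ a₃ +ᶻ mk b₀ b₁ b₂ b₃ = mk (a₀ ℚ.+ b₀) (a₁ ℚ.+ b₁) (a₂ ℚ.+ b₂) (a₃ ℚ.+ b₃)

-ᶻ_ : ℚ[ζ] → ℚ[ζ]
-ᶻ mk a₀ a₁ a₂ a₃ = mk (ℚ.- a₀) (ℚ.- a₁) (ℚ.- a₂) (ℚ.- a₃)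

_*ᶻ_ : ℚ[ζ] → ℚ[ζ] → ℚ[ζ]
mk a₀ a₁ a₂ a₃ *ᶻ mk b₀ b₁ b₂ b₃ = mk
  (a₀ ℚ.* b₀ ℚ.- a₁ ℚ.* b₃ ℚ.- a₂ ℚ.* b₂ ℚ.- a₃ ℚ.* b₁)
  (a₀ ℚ.* b₁ ℚ.+ a₁ ℚ.* b₀ ℚ.- a₂ ℚ.* b₃ ℚ.- a₃ ℚ.* b₂)
  (a₀ ℚ.* b₂ ℚ.+ a₁ ℚ.* b₁ ℚ.+ a₂ ℚ.* b₀ ℚ.- a₃ ℚ.* b₃)
  (a₀ ℚ.* b₃ ℚ.+ a₁ ℚ.* b₂ ℚ.+ a₂ ℚ.* b₁ ℚ.+ a₃ ℚ.* b₀)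

fromℚ : ℚ → ℚ[ζ]
fromℚ q = mk q 0ℚ 0ℚ 0ℚ

0ᶻ 1ᶻ ζ : ℚ[ζ]
0ᶻ = fromℚ 0ℚ
1ᶻ = fromℚ 1ℚ
ζ = mk 0ℚ 1ℚ 0ℚ 0ℚ

mk-cong : ∀ {a₀ a₁ a₂ a₃ b₀ b₁ b₂ b₃} → a₀ ≡ b₀ → a₁ ≡ b₁ → a₂ ≡ b₂ → a₃ ≡ b₃ →
          mk a₀ a₁ a₂ a₃ ≡ mk b₀ b₁ b₂ b₃
mk-cong refl refl refl refl = refl

+ᶻ-assoc : ∀ x y z → (x +ᶻ y) +ᶻ z ≡ x +ᶻ (y +ᶻ z)
+ᶻ-assoc (mk a₀ a₁ a₂ a₃) (mk b₀ b₁ b₂ b₃) (mk c₀ c₁ c₂ c₃) =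
  mk-cong (ℚ.+-assoc a₀ b₀ c₀) (ℚ.+-assoc a₁ b₁ c₁) (ℚ.+-assoc a₂ b₂ c₂) (ℚ.+-assoc a₃ b₃ c₃)

+ᶻ-comm : ∀ x y → x +ᶻ y ≡ y +ᶻ x
+ᶻ-comm (mk a₀ a₁ a₂ a₃) (mk b₀ b₁ b₂ b₃) =
  mk-cong (ℚ.+-comm a₀ b₀) (ℚ.+-comm a₁ b₁) (ℚ.+-comm a₂ b₂) (ℚ.+-comm a₃ b₃)

+ᶻ-identityˡ : ∀ x → 0ᶻ +ᶻ x ≡ x
+ᶻ-identityˡ (mk a₀ a₁ a₂ a₃) =
  mk-cong (ℚ.+-identityˡ a₀) (ℚ.+-identityˡ a₁) (ℚ.+-identityˡ a₂) (ℚ.+-identityˡ a₃)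

+ᶻ-inverseˡ : ∀ x → -ᶻ x +ᶻ x ≡ 0ᶻ
+ᶻ-inverseˡ (mk a₀ a₁ a₂ a₃) =
  mk-cong (ℚ.+-inverseˡ a₀) (ℚ.+-inverseˡ a₁) (ℚ.+-inverseˡ a₂) (ℚ.+-inverseˡ a₃)

*ᶻ-assoc : ∀ x y z → (x *ᶻ y) *ᶻ z ≡ x *ᶻ (y *ᶻ z)
*ᶻ-assoc (mk a₀ a₁ a₂ a₃) (mk b₀ b₁ b₂ b₃) (mk c₀ c₁ c₂ c₃) =
  mk-cong (solve vs ℚ-ring) (solve vs ℚ-ring) (solve vs ℚ-ring) (solve vs ℚ-ring)
  where vs = a₀ ∷ a₁ ∷ a₂ ∷ a₃ ∷ b₀ ∷ b₁ ∷ b₂ ∷ b₃ ∷ c₀ ∷ c₁ ∷ c₂ ∷ c₃ ∷ []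

*ᶻ-comm : ∀ x y → x *ᶻ y ≡ y *ᶻ x
*ᶻ-comm (mk a₀ a₁ a₂ a₃) (mk b₀ b₁ b₂ b₃) =
  mk-cong (solve vs ℚ-ring) (solve vs ℚ-ring) (solve vs ℚ-ring) (solve vs ℚ-ring)
  where vs = a₀ ∷ a₁ ∷ a₂ ∷ a₃ ∷ b₀ ∷ b₁ ∷ b₂ ∷ b₃ ∷ []

*ᶻ-identityˡ : ∀ x → 1ᶻ *ᶻ x ≡ x
*ᶻ-identityˡ (mk a₀ a₁ a₂ a₃) =
  mk-cong (solve vs ℚ-ring) (solve vs ℚ-ring) (solve vs ℚ-ring) (solve vs ℚ-ring)
  where vs = a₀ ∷ a₁ ∷ a₂ ∷ a₃ ∷ []

*ᶻ-distribʳ : ∀ x y z → (y +ᶻ z) *ᶻ x ≡ y *ᶻ x +ᶻ z *ᶻ x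
*ᶻ-distribʳ (mk a₀ a₁ a₂ a₃) (mk b₀ b₁ b₂ b₃) (mk c₀ c₁ c₂ c₃) =
  mk-cong (solve vs ℚ-ring) (solve vs ℚ-ring) (solve vs ℚ-ring) (solve vs ℚ-ring)
  where vs = a₀ ∷ a₁ ∷ a₂ ∷ a₃ ∷ b₀ ∷ b₁ ∷ b₂ ∷ b₃ ∷ c₀ ∷ c₁ ∷ c₂ ∷ c₃ ∷ []

ℚ[ζ]-commutativeRing : CommutativeRing 0ℓ 0ℓ
ℚ[ζ]-commutativeRing = record
  { Carrier = ℚ[ζ] ; _≈_ = _≡_ ; _+_ = _+ᶻ_ ; _*_ = _*ᶻ_ ; -_ = -ᶻ_ ; 0# = 0ᶻ ; 1# = 1ᶻ
  ; isCommutativeRing = record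
    { isRing = record
      { +-isAbelianGroup = record
        { isGroup = record
          { isMonoid = record
            { isSemigroup = record
              { isMagma = record { isEquivalence = isEquivalence ; ∙-cong = cong₂ _+ᶻ_ }
              ; assoc = +ᶻ-assoc }
            ; identity = comm∧idˡ⇒id +ᶻ-comm +ᶻ-identityˡ }
          ; inverse = comm∧invˡ⇒inv +ᶻ-comm +ᶻ-inverseˡ
          ; ⁻¹-cong = cong -ᶻ_ }
        ; comm = +ᶻ-comm }
      ; *-cong = cong₂ _*ᶻ_
      ; *-assoc = *ᶻ-assoc
      ; *-identity = comm∧idˡ⇒id *ᶻ-comm *ᶻ-identityˡ
      ; distrib = comm∧distrʳ⇒distrˡ *ᶻ-comm *ᶻ-distribʳ , *ᶻ-distribʳ }
    ; *-comm = *ᶻ-comm } }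

infix 4 _≟ᶻ_

_≟ᶻ_ : (x y : ℚ[ζ]) → Dec (x ≡ y)
mk a₀ a₁ a₂ a₃ ≟ᶻ mk b₀ b₁ b₂ b₃ =
  map′ (λ (e₀ , e₁ , e₂ , e₃) → mk-cong e₀ e₁ e₂ e₃) (λ { refl → refl , refl , refl , refl })
       (a₀ ℚ.≟ b₀ ×-dec a₁ ℚ.≟ b₁ ×-dec a₂ ℚ.≟ b₂ ×-dec a₃ ℚ.≟ b₃)

ℚ[ζ]-ring : ACR.AlmostCommutativeRing 0ℓ 0ℓ
ℚ[ζ]-ring = ACR.fromCommutativeRing ℚ[ζ]-commutativeRing (λ x → dec⇒maybe (0ᶻ ≟ᶻ x))

open CommutativeRing ℚ[ζ]-commutativeRing using (semiring; commutativeSemiring; +-commutativeSemigroup; *-commutativeSemigroup; zeroˡ; zeroʳ)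
  renaming (+-identityʳ to +ᶻ-identityʳ; *-identityʳ to *ᶻ-identityʳ; distribˡ to *ᶻ-distribˡ)
open import Algebra.Properties.CommutativeSemigroup +-commutativeSemigroup using () renaming (interchange to +ᶻ-interchange)
open import Algebra.Properties.CommutativeSemigroup *-commutativeSemigroup using (x∙yz≈y∙xz)
open import Algebra.Properties.Semiring.Sum semiring
  using (sum; sum-syntax; ∑-permute; sum-cong-≗; sum-replicate-zero; sum-remove; *-distribˡ-sum; *-distribʳ-sum)
open import Algebra.Properties.Semiring.Mult semiring using (×-assoc-*; ×1-homo-*)
  renaming (_×_ to _×ᶻ_)
open import Algebra.Properties.Semiring.Exp semiring using (^-homo-*; ^-assocʳ) renaming (_^_ to _^ᶻ_)
open import Algebra.Properties.CommutativeSemiring.Exp commutativeSemiring using (^-distrib-*)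
import Algebra.Properties.CommutativeSemiring.Binomial commutativeSemiring as Binomial

fromℕ : ℕ → ℚ[ζ]
fromℕ n = n ×ᶻ 1ᶻ

×ᶻ-as-* : ∀ n x → n ×ᶻ x ≡ fromℕ n *ᶻ x
×ᶻ-as-* n x = sym (trans (×-assoc-* n 1ᶻ x) (cong (n ×ᶻ_) (*ᶻ-identityˡ x)))

fromℕ-* : ∀ m n → fromℕ (m * n) ≡ fromℕ m *ᶻ fromℕ n
fromℕ-* = ×1-homo-*

-ᶻ-as-* : ∀ x → -ᶻ x ≡ (-ᶻ 1ᶻ) *ᶻ x
-ᶻ-as-* = solve-∀ ℚ[ζ]-ring

1ᶻ^ : ∀ n → 1ᶻ ^ᶻ n ≡ 1ᶻ
1ᶻ^ zero    = refl
1ᶻ^ (suc n) = trans (*ᶻ-identityˡ (1ᶻ ^ᶻ n)) (1ᶻ^ n)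

Σ : ℕ → (ℕ → ℚ[ζ]) → ℚ[ζ]
Σ zero    f = 0ᶻ
Σ (suc n) f = f 0 +ᶻ Σ n (f ∘ suc)

Σ-as-∑ : ∀ n f → Σ n f ≡ ∑[ i < n ] f (toℕ i)
Σ-as-∑ zero    f = refl
Σ-as-∑ (suc n) f = cong (f 0 +ᶻ_) (Σ-as-∑ n (f ∘ suc))

Σ-cong : ∀ n {f g} → (∀ i → i < n → f i ≡ g i) → Σ n f ≡ Σ n g
Σ-cong zero    f≗g = refl
Σ-cong (suc n) f≗g = cong₂ _+ᶻ_ (f≗g 0 (ℕ.s≤s ℕ.z≤n)) (Σ-cong n (λ i i<n → f≗g (suc i) (ℕ.s≤s i<n)))

Σ-zero : ∀ n {f} → (∀ i → i < n → f i ≡ 0ᶻ) → Σ n f ≡ 0ᶻ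
Σ-zero n f≗0 = trans (Σ-cong n f≗0) (Σ-const n)
  where
  Σ-const : ∀ n → Σ n (λ _ → 0ᶻ) ≡ 0ᶻ
  Σ-const zero    = refl
  Σ-const (suc n) = trans (cong (0ᶻ +ᶻ_) (Σ-const n)) (+ᶻ-identityˡ 0ᶻ)

Σ-+ : ∀ n f g → Σ n (λ i → f i +ᶻ g i) ≡ Σ n f +ᶻ Σ n g
Σ-+ zero    f g = sym (+ᶻ-identityˡ 0ᶻ)
Σ-+ (suc n) f g = trans (cong (f 0 +ᶻ g 0 +ᶻ_) (Σ-+ n (f ∘ suc) (g ∘ suc))) (+ᶻ-interchange _ _ _ _)

Σ-*ˡ : ∀ n c f → c *ᶻ Σ n f ≡ Σ n (λ i → c *ᶻ f i)
Σ-*ˡ zero    c f = zeroʳ c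
Σ-*ˡ (suc n) c f = trans (*ᶻ-distribˡ c (f 0) _) (cong (c *ᶻ f 0 +ᶻ_) (Σ-*ˡ n c (f ∘ suc)))

Σ-comm : ∀ m n (f : ℕ → ℕ → ℚ[ζ]) → Σ m (λ i → Σ n (f i)) ≡ Σ n (λ j → Σ m (λ i → f i j))
Σ-comm zero    n f = sym (Σ-zero n (λ _ _ → refl))
Σ-comm (suc m) n f = trans (cong (Σ n (f 0) +ᶻ_) (Σ-comm m n (f ∘ suc))) (sym (Σ-+ n (f 0) _))

Σ-snoc : ∀ n f → Σ (suc n) f ≡ Σ n f +ᶻ f n
Σ-snoc zero    f = trans (+ᶻ-identityʳ (f 0)) (sym (+ᶻ-identityˡ (f 0)))
Σ-snoc (suc n) f = trans (cong (f 0 +ᶻ_) (Σ-snoc n (f ∘ suc))) (sym (+ᶻ-assoc _ _ _))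

Σ-++ : ∀ m n f → Σ (m + n) f ≡ Σ m f +ᶻ Σ n (λ i → f (m + i))
Σ-++ zero    n f = sym (+ᶻ-identityˡ _)
Σ-++ (suc m) n f = begin
  f 0 +ᶻ Σ (m + n) (f ∘ suc)                         ≡⟨ cong (f 0 +ᶻ_) (Σ-++ m n (f ∘ suc)) ⟩
  f 0 +ᶻ (Σ m (f ∘ suc) +ᶻ Σ n (λ i → f (suc m + i))) ≡⟨ sym (+ᶻ-assoc _ _ _) ⟩
  Σ (suc m) f +ᶻ Σ n (λ i → f (suc m + i))            ∎

Σ-extend : ∀ {m n} f → m ≤ n → (∀ i → m ≤ i → f i ≡ 0ᶻ) → Σ n f ≡ Σ m f
Σ-extend {m} {n} f m≤n tail≡0 = begin
  Σ n f                                  ≡⟨ cong (λ k → Σ k f) (sym (ℕ.m+[n∸m]≡n m≤n)) ⟩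
  Σ (m + (n ∸ m)) f                      ≡⟨ Σ-++ m (n ∸ m) f ⟩
  Σ m f +ᶻ Σ (n ∸ m) (λ i → f (m + i))   ≡⟨ cong (Σ m f +ᶻ_) (Σ-zero (n ∸ m) (λ i _ → tail≡0 (m + i) (ℕ.m≤m+n m i))) ⟩
  Σ m f +ᶻ 0ᶻ                            ≡⟨ +ᶻ-identityʳ _ ⟩
  Σ m f                                  ∎

Σ-blocks : ∀ q d f → Σ (q * d) f ≡ Σ q (λ k → Σ d (λ r → f (k * d + r)))
Σ-blocks zero    d f = refl
Σ-blocks (suc q) d f = begin
  Σ (d + q * d) f                                        ≡⟨ Σ-++ d (q * d) f ⟩
  Σ d f +ᶻ Σ (q * d) (λ i → f (d + i))                   ≡⟨ cong (Σ d f +ᶻ_) (Σ-blocks q d (λ i → f (d + i))) ⟩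
  Σ d f +ᶻ Σ q (λ k → Σ d (λ r → f (d + (k * d + r))))   ≡⟨ cong (Σ d f +ᶻ_) (Σ-cong q (λ k _ → Σ-cong d (λ r _ →
                                                              cong f (sym (ℕ.+-assoc d (k * d) r))))) ⟩
  Σ (suc q) (λ k → Σ d (λ r → f (k * d + r)))            ∎

Σ-reverse : ∀ n f → Σ n f ≡ Σ n (λ i → f (n ∸ suc i))
Σ-reverse n f = begin
  Σ n f                                  ≡⟨ Σ-as-∑ n f ⟩
  ∑[ i < n ] f (toℕ i)                   ≡⟨ ∑-permute {n} (f ∘ toℕ) Perm.reverse ⟩
  ∑[ i < n ] f (toℕ (Fin.opposite i))    ≡⟨ sum-cong-≗ {n} {y = λ i → f (n ∸ suc (toℕ i))} (cong f ∘ Fin.opposite-prop) ⟩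
  ∑[ i < n ] f (n ∸ suc (toℕ i))         ≡⟨ sym (Σ-as-∑ n _) ⟩
  Σ n (λ i → f (n ∸ suc i))              ∎

Σ-single : ∀ n {f} (i : Fin (suc n)) → (∀ j → j ≢ i → f (toℕ j) ≡ 0ᶻ) → Σ (suc n) f ≡ f (toℕ i)
Σ-single n {f} i others = begin
  Σ (suc n) f                                 ≡⟨ Σ-as-∑ (suc n) f ⟩
  ∑[ j < suc n ] f (toℕ j)                    ≡⟨ sum-remove {n} {i} (f ∘ toℕ) ⟩
  f (toℕ i) +ᶻ sum (removeAt (f ∘ toℕ) i)     ≡⟨ cong (f (toℕ i) +ᶻ_) rest ⟩
  f (toℕ i) +ᶻ 0ᶻ                             ≡⟨ +ᶻ-identityʳ _ ⟩
  f (toℕ i)                                   ∎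
  where
  rest : sum (removeAt (f ∘ toℕ) i) ≡ 0ᶻ
  rest = trans (sum-cong-≗ {n} {y = λ _ → 0ᶻ} (λ j → others _ (Fin.punchInᵢ≢i i j))) (sum-replicate-zero n)

fromℚ-* : ∀ p q → fromℚ (p ℚ.* q) ≡ fromℚ p *ᶻ fromℚ q
fromℚ-* p q = mk-cong (solve vs ℚ-ring) (solve vs ℚ-ring) (solve vs ℚ-ring) (solve vs ℚ-ring)
  where vs = p ∷ q ∷ []

ℕtoℚ-suc : ∀ n → ℕtoℚ (suc n) ≡ 1ℚ ℚ.+ ℕtoℚ n
ℕtoℚ-suc n = ℚ.toℚᵘ-injective (beginᵘ
  ℚ.toℚᵘ (ℕtoℚ (suc n))                   ≈⟨ ℚ.toℚᵘ-fromℚᵘ (ℚᵘ.mkℚᵘ (+ suc n) 0) ⟩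
  ℚᵘ.mkℚᵘ (+ suc n) 0                     ≈⟨ ℚᵘ.*≡* (cross-multiplied (+ n)) ⟩
  ℚᵘ.mkℚᵘ (+ 1) 0 ℚᵘ.+ ℚᵘ.mkℚᵘ (+ n) 0    ≈⟨ ℚᵘ.+-cong ℚᵘ.≃-refl (ℚᵘ.≃-sym (ℚ.toℚᵘ-fromℚᵘ (ℚᵘ.mkℚᵘ (+ n) 0))) ⟩
  ℚᵘ.mkℚᵘ (+ 1) 0 ℚᵘ.+ ℚ.toℚᵘ (ℕtoℚ n)   ≈⟨ ℚᵘ.≃-sym (ℚ.toℚᵘ-homo-+ 1ℚ (ℕtoℚ n)) ⟩
  ℚ.toℚᵘ (1ℚ ℚ.+ ℕtoℚ n)                  ∎ᵘ)
  where
  open ℚᵘ.≃-Reasoning renaming (begin_ to beginᵘ_; _∎ to _∎ᵘ)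
  cross-multiplied : ∀ k → (+ 1 ℤ.+ k) ℤ.* + 1 ≡ (+ 1 ℤ.+ k ℤ.* + 1) ℤ.* + 1
  cross-multiplied = ℤ-solve-∀

ℕtoℚ-*-inverse : ∀ m → ℕtoℚ (suc m) ℚ.* (+ 1 ℚ./ suc m) ≡ 1ℚ
ℕtoℚ-*-inverse m = ℚ.toℚᵘ-injective (beginᵘ
  ℚ.toℚᵘ (ℕtoℚ (suc m) ℚ.* (+ 1 ℚ./ suc m))             ≈⟨ ℚ.toℚᵘ-homo-* (ℕtoℚ (suc m)) (+ 1 ℚ./ suc m) ⟩
  ℚ.toℚᵘ (ℕtoℚ (suc m)) ℚᵘ.* ℚ.toℚᵘ (+ 1 ℚ./ suc m)    ≈⟨ ℚᵘ.*-cong (ℚ.toℚᵘ-fromℚᵘ (ℚᵘ.mkℚᵘ (+ suc m) 0)) (ℚ.toℚᵘ-fromℚᵘ (ℚᵘ.mkℚᵘ (+ 1) m)) ⟩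
  ℚᵘ.mkℚᵘ (+ suc m) 0 ℚᵘ.* ℚᵘ.mkℚᵘ (+ 1) m              ≈⟨ ℚᵘ.*≡* (cross-multiplied (+ suc m)) ⟩
  ℚ.toℚᵘ 1ℚ                                             ∎ᵘ)
  where
  open ℚᵘ.≃-Reasoning renaming (begin_ to beginᵘ_; _∎ to _∎ᵘ)
  cross-multiplied : ∀ k → (k ℤ.* + 1) ℤ.* + 1 ≡ + 1 ℤ.* (+ 1 ℤ.* k)
  cross-multiplied = ℤ-solve-∀

fromℚ-ℕtoℚ : ∀ n → fromℚ (ℕtoℚ n) ≡ fromℕ n
fromℚ-ℕtoℚ zero    = refl
fromℚ-ℕtoℚ (suc n) = trans (cong fromℚ (ℕtoℚ-suc n)) (cong (1ᶻ +ᶻ_) (fromℚ-ℕtoℚ n))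

Σ-foldr : ∀ {A : Set} (_∙_ : A → A → A) (ε : A) (h : A → ℚ[ζ]) → h ε ≡ 0ᶻ → (∀ x y → h (x ∙ y) ≡ h x +ᶻ h y) →
          ∀ n (f : ℕ → A) (g : ℕ → ℕ) → h (foldr _∙_ ε (map f (applyUpTo g n))) ≡ Σ n (λ i → h (f (g i)))
Σ-foldr _∙_ ε h h-ε h-∙ zero    f g = h-ε
Σ-foldr _∙_ ε h h-ε h-∙ (suc n) f g =
  trans (h-∙ _ _) (cong (h (f (g 0)) +ᶻ_) (Σ-foldr _∙_ ε h h-ε h-∙ n f (g ∘ suc)))

fromℚ-sumℚ : ∀ n (f : ℕ → ℚ) → fromℚ (sumℚ (map f (upTo n))) ≡ Σ n (fromℚ ∘ f)
fromℚ-sumℚ n f = Σ-foldr ℚ._+_ 0ℚ fromℚ refl (λ _ _ → refl) n f (λ i → i)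

B̂ : ℕ → ℚ[ζ]
B̂ k = fromℚ (B k)

length-bernTable : ∀ m → length (bernTable m) ≡ m
length-bernTable zero    = refl
length-bernTable (suc m) = trans (List.length-++ (bernTable m)) (trans (ℕ.+-comm _ 1) (cong suc (length-bernTable m)))

at-bernTable : ∀ {m k} → k < m → at (bernTable m) k ≡ B k
at-bernTable {suc m} {k} k<1+m with ℕ.m≤n⇒m<n∨m≡n (ℕ.≤-pred k<1+m)
... | inj₁ k<m  = trans (at-++ˡ (bernTable m) (subst (k <_) (sym (length-bernTable m)) k<m)) (at-bernTable k<m)
  where
  at-++ˡ : ∀ {k} xs {ys} → k < length xs → at (xs ++ ys) k ≡ at xs k
  at-++ˡ {zero}  (x ∷ xs) _            = refl
  at-++ˡ {suc k} (x ∷ xs) (ℕ.s≤s k<n) = at-++ˡ xs k<n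
... | inj₂ refl = subst (λ j → at (bernTable (suc k)) j ≡ B k) (length-bernTable k) (at-++-last (bernTable k))
  where
  at-++-last : ∀ xs {y} → at (xs ++ y ∷ []) (length xs) ≡ y
  at-++-last []       = refl
  at-++-last (x ∷ xs) = at-++-last xs

δ₁ : ℕ → ℚ[ζ]
δ₁ 1 = 1ᶻ
δ₁ _ = 0ᶻ

Σ-binomial-B̂ : ∀ M → Σ (suc M) (λ r → fromℕ (M C r) *ᶻ B̂ r) ≡ B̂ M +ᶻ δ₁ M
Σ-binomial-B̂ zero          = refl
Σ-binomial-B̂ (suc zero)    = refl
Σ-binomial-B̂ (suc (suc m)) = begin
  Σ (suc M) g                                               ≡⟨ Σ-snoc M g ⟩
  Σ M g +ᶻ g M                                              ≡⟨ cong (_+ᶻ g M) (Σ-snoc (suc m) g) ⟩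
  Σ (suc m) g +ᶻ g (suc m) +ᶻ g M                           ≡⟨ cong₂ (λ x y → x +ᶻ y +ᶻ g M) lower-terms penultimate-term ⟩
  fromℚ (S ℚ.+ ℕtoℚ M ℚ.* B (suc m)) +ᶻ g M                ≡⟨ cong₂ _+ᶻ_ (cong fromℚ (cancel S {ℕtoℚ M} (ℕtoℚ-*-inverse (suc m)))) last-term ⟩
  0ᶻ +ᶻ B̂ M                                                 ≡⟨ trans (+ᶻ-identityˡ (B̂ M)) (sym (+ᶻ-identityʳ (B̂ M))) ⟩
  B̂ M +ᶻ 0ᶻ                                                 ∎
  where
  M = suc (suc m)
  g : ℕ → ℚ[ζ]
  g r = fromℕ (M C r) *ᶻ B̂ r
  s : ℕ → ℚ
  s k = ℕtoℚ (M C k) ℚ.* at (bernTable (suc m)) k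
  S : ℚ
  S = sumℚ (map s (upTo (suc m)))
  lower-terms : Σ (suc m) g ≡ fromℚ S
  lower-terms = sym (trans (fromℚ-sumℚ (suc m) s) (Σ-cong (suc m) λ k k<1+m →
    trans (fromℚ-* (ℕtoℚ (M C k)) _) (cong₂ _*ᶻ_ (fromℚ-ℕtoℚ (M C k)) (cong fromℚ (at-bernTable k<1+m)))))
  penultimate-term : g (suc m) ≡ fromℚ (ℕtoℚ M ℚ.* B (suc m))
  penultimate-term = begin
    fromℕ (M C suc m) *ᶻ B̂ (suc m)        ≡⟨ cong (λ c → fromℕ c *ᶻ B̂ (suc m)) ([1+n]C[n]≡1+n (suc m)) ⟩
    fromℕ M *ᶻ B̂ (suc m)                  ≡⟨ cong (_*ᶻ B̂ (suc m)) (sym (fromℚ-ℕtoℚ M)) ⟩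
    fromℚ (ℕtoℚ M) *ᶻ fromℚ (B (suc m))   ≡⟨ sym (fromℚ-* (ℕtoℚ M) (B (suc m))) ⟩
    fromℚ (ℕtoℚ M ℚ.* B (suc m))          ∎
  last-term : g M ≡ B̂ M
  last-term = trans (cong (λ c → fromℕ c *ᶻ B̂ M) (nCn≡1 M)) (*ᶻ-identityˡ (B̂ M))
  cancel : ∀ s {a b} → a ℚ.* b ≡ 1ℚ → s ℚ.+ a ℚ.* ℚ.- (b ℚ.* s) ≡ 0ℚ
  cancel s {a} {b} ab≡1 = begin
    s ℚ.+ a ℚ.* ℚ.- (b ℚ.* s)   ≡⟨ solve (s ∷ a ∷ b ∷ []) ℚ-ring ⟩
    s ℚ.- a ℚ.* b ℚ.* s         ≡⟨ cong (λ x → s ℚ.- x ℚ.* s) ab≡1 ⟩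
    s ℚ.- 1ℚ ℚ.* s              ≡⟨ solve (s ∷ []) ℚ-ring ⟩
    0ℚ                          ∎

binomialTerm : ℕ → ℚ[ζ] → ℚ[ζ] → ℕ → ℚ[ζ]
binomialTerm n x y k = fromℕ (n C k) *ᶻ (x ^ᶻ k *ᶻ y ^ᶻ (n ∸ k))

binomialTerm-vanishes : ∀ {n k} x y → n < k → binomialTerm n x y k ≡ 0ᶻ
binomialTerm-vanishes {n} {k} x y n<k =
  trans (cong (λ c → fromℕ c *ᶻ (x ^ᶻ k *ᶻ y ^ᶻ (n ∸ k))) (k>n⇒nCk≡0 n<k)) (zeroˡ _)

binomialTerm-penultimate : ∀ n x y → binomialTerm (suc n) x y n ≡ fromℕ (suc n) *ᶻ y *ᶻ x ^ᶻ n
binomialTerm-penultimate n x y = begin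
  fromℕ (suc n C n) *ᶻ (x ^ᶻ n *ᶻ y ^ᶻ (suc n ∸ n))   ≡⟨ cong₂ (λ k e → fromℕ k *ᶻ (x ^ᶻ n *ᶻ y ^ᶻ e)) ([1+n]C[n]≡1+n n) (ℕ.m+n∸n≡m 1 n) ⟩
  fromℕ (suc n) *ᶻ (x ^ᶻ n *ᶻ (y *ᶻ 1ᶻ))              ≡⟨ regroup (fromℕ (suc n)) (x ^ᶻ n) y ⟩
  fromℕ (suc n) *ᶻ y *ᶻ x ^ᶻ n                        ∎
  where
  regroup : ∀ c p r → c *ᶻ (p *ᶻ (r *ᶻ 1ᶻ)) ≡ c *ᶻ r *ᶻ p
  regroup = solve-∀ ℚ[ζ]-ring

binomial : ∀ n x y → (x +ᶻ y) ^ᶻ n ≡ Σ (suc n) (binomialTerm n x y)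
binomial n x y = begin
  (x +ᶻ y) ^ᶻ n                                                  ≡⟨ Binomial.theorem n x y ⟩
  ∑[ k < suc n ] ((n C toℕ k) ×ᶻ (x ^ᶻ toℕ k *ᶻ y ^ᶻ (n ∸ toℕ k))) ≡⟨ sym (Σ-as-∑ (suc n) term) ⟩
  Σ (suc n) term                                                 ≡⟨ Σ-cong (suc n) (λ k _ → ×ᶻ-as-* (n C k) (x ^ᶻ k *ᶻ y ^ᶻ (n ∸ k))) ⟩
  Σ (suc n) (binomialTerm n x y)                                 ∎
  where
  term : ℕ → ℚ[ζ]
  term k = (n C k) ×ᶻ (x ^ᶻ k *ᶻ y ^ᶻ (n ∸ k))

binomial-padded : ∀ {n N} x y → n ≤ N → (x +ᶻ y) ^ᶻ n ≡ Σ (suc N) (binomialTerm n x y)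
binomial-padded {n} {N} x y n≤N =
  trans (binomial n x y) (sym (Σ-extend (binomialTerm n x y) (ℕ.s≤s n≤N) (λ k n<k → binomialTerm-vanishes x y n<k)))

fromℕ-C-trinomial : ∀ {N i j} → j ≤ i → i ≤ N → fromℕ (N C i) *ᶻ fromℕ (i C j) ≡ fromℕ (N C j) *ᶻ fromℕ ((N ∸ j) C (N ∸ i))
fromℕ-C-trinomial {N} {i} {j} j≤i i≤N = begin
  fromℕ (N C i) *ᶻ fromℕ (i C j)                ≡⟨ sym (fromℕ-* (N C i) (i C j)) ⟩
  fromℕ ((N C i) * (i C j))                     ≡⟨ cong fromℕ (C-trinomial j≤i i≤N) ⟩
  fromℕ ((N C j) * ((N ∸ j) C (N ∸ i)))         ≡⟨ fromℕ-* (N C j) ((N ∸ j) C (N ∸ i)) ⟩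
  fromℕ (N C j) *ᶻ fromℕ ((N ∸ j) C (N ∸ i))    ∎

^-∸-telescope : ∀ ρ {N i j} → j ≤ i → i ≤ N → ρ ^ᶻ (N ∸ i) *ᶻ ρ ^ᶻ (i ∸ j) ≡ ρ ^ᶻ (N ∸ j)
^-∸-telescope ρ {N} {i} {j} j≤i i≤N = begin
  ρ ^ᶻ (N ∸ i) *ᶻ ρ ^ᶻ (i ∸ j)   ≡⟨ sym (^-homo-* ρ (N ∸ i) (i ∸ j)) ⟩
  ρ ^ᶻ (N ∸ i + (i ∸ j))         ≡⟨ cong (ρ ^ᶻ_) (trans (sym (ℕ.+-∸-assoc (N ∸ i) j≤i)) (cong (_∸ j) (ℕ.m∸n+n≡m i≤N))) ⟩
  ρ ^ᶻ (N ∸ j)                   ∎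

bernoulliCoeff : ℕ → ℚ[ζ] → ℕ → ℚ[ζ]
bernoulliCoeff N ρ i = fromℕ (N C i) *ᶻ B̂ (N ∸ i) *ᶻ ρ ^ᶻ (N ∸ i)

-- ρᴺ B_N(w / ρ): the N-th Bernoulli polynomial, made homogeneous.
bernoulliForm : ℕ → ℚ[ζ] → ℚ[ζ] → ℚ[ζ]
bernoulliForm N ρ w = Σ (suc N) (λ i → bernoulliCoeff N ρ i *ᶻ w ^ᶻ i)

bernoulliCoeff-*-binomialTerm : ∀ {N i j} ρ w → i ≤ N → j ≤ N →
  bernoulliCoeff N ρ i *ᶻ binomialTerm i w ρ j ≡ binomialTerm N w ρ j *ᶻ (fromℕ ((N ∸ j) C (N ∸ i)) *ᶻ B̂ (N ∸ i))
bernoulliCoeff-*-binomialTerm {N} {i} {j} ρ w i≤N j≤N with ℕ.≤-<-connex j i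
... | inj₁ j≤i = begin
  fromℕ (N C i) *ᶻ B̂ (N ∸ i) *ᶻ ρ ^ᶻ (N ∸ i) *ᶻ (fromℕ (i C j) *ᶻ (w ^ᶻ j *ᶻ ρ ^ᶻ (i ∸ j)))
    ≡⟨ regroup (fromℕ (N C i)) (B̂ (N ∸ i)) (ρ ^ᶻ (N ∸ i)) (fromℕ (i C j)) (w ^ᶻ j) (ρ ^ᶻ (i ∸ j)) ⟩
  fromℕ (N C i) *ᶻ fromℕ (i C j) *ᶻ (w ^ᶻ j *ᶻ (ρ ^ᶻ (N ∸ i) *ᶻ ρ ^ᶻ (i ∸ j))) *ᶻ B̂ (N ∸ i)
    ≡⟨ cong₂ (λ c p → c *ᶻ (w ^ᶻ j *ᶻ p) *ᶻ B̂ (N ∸ i)) (fromℕ-C-trinomial j≤i i≤N) (^-∸-telescope ρ j≤i i≤N) ⟩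
  fromℕ (N C j) *ᶻ fromℕ ((N ∸ j) C (N ∸ i)) *ᶻ (w ^ᶻ j *ᶻ ρ ^ᶻ (N ∸ j)) *ᶻ B̂ (N ∸ i)
    ≡⟨ regroup′ (fromℕ (N C j)) (fromℕ ((N ∸ j) C (N ∸ i))) (w ^ᶻ j *ᶻ ρ ^ᶻ (N ∸ j)) (B̂ (N ∸ i)) ⟩
  fromℕ (N C j) *ᶻ (w ^ᶻ j *ᶻ ρ ^ᶻ (N ∸ j)) *ᶻ (fromℕ ((N ∸ j) C (N ∸ i)) *ᶻ B̂ (N ∸ i))
    ∎
  where
  regroup : ∀ a b c d e f → a *ᶻ b *ᶻ c *ᶻ (d *ᶻ (e *ᶻ f)) ≡ a *ᶻ d *ᶻ (e *ᶻ (c *ᶻ f)) *ᶻ b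
  regroup = solve-∀ ℚ[ζ]-ring
  regroup′ : ∀ a b c d → a *ᶻ b *ᶻ c *ᶻ d ≡ a *ᶻ c *ᶻ (b *ᶻ d)
  regroup′ = solve-∀ ℚ[ζ]-ring
... | inj₂ i<j = begin
  bernoulliCoeff N ρ i *ᶻ binomialTerm i w ρ j       ≡⟨ cong (bernoulliCoeff N ρ i *ᶻ_) (binomialTerm-vanishes w ρ i<j) ⟩
  bernoulliCoeff N ρ i *ᶻ 0ᶻ                          ≡⟨ zeroʳ _ ⟩
  0ᶻ                                                  ≡⟨ sym (zeroʳ _) ⟩
  binomialTerm N w ρ j *ᶻ 0ᶻ                          ≡⟨ cong (binomialTerm N w ρ j *ᶻ_) (sym (trans
                                                           (cong (λ c → fromℕ c *ᶻ B̂ (N ∸ i)) (k>n⇒nCk≡0 (ℕ.∸-monoʳ-< i<j j≤N)))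
                                                           (zeroˡ (B̂ (N ∸ i))))) ⟩
  binomialTerm N w ρ j *ᶻ (fromℕ ((N ∸ j) C (N ∸ i)) *ᶻ B̂ (N ∸ i)) ∎

Σ-column : ∀ {N j} → j ≤ N → Σ (suc N) (λ i → fromℕ ((N ∸ j) C (N ∸ i)) *ᶻ B̂ (N ∸ i)) ≡ B̂ (N ∸ j) +ᶻ δ₁ (N ∸ j)
Σ-column {N} {j} j≤N = begin
  Σ (suc N) (λ i → g (N ∸ i))         ≡⟨ Σ-reverse (suc N) (λ i → g (N ∸ i)) ⟩
  Σ (suc N) (λ l → g (N ∸ (N ∸ l)))   ≡⟨ Σ-cong (suc N) (λ l l<1+N → cong g (ℕ.m∸[m∸n]≡n (ℕ.≤-pred l<1+N))) ⟩
  Σ (suc N) g                         ≡⟨ Σ-extend g (ℕ.s≤s (ℕ.m∸n≤m N j)) (λ l N∸j<l →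
                                           trans (cong (λ c → fromℕ c *ᶻ B̂ l) (k>n⇒nCk≡0 N∸j<l)) (zeroˡ (B̂ l))) ⟩
  Σ (suc (N ∸ j)) g                   ≡⟨ Σ-binomial-B̂ (N ∸ j) ⟩
  B̂ (N ∸ j) +ᶻ δ₁ (N ∸ j)             ∎
  where
  g : ℕ → ℚ[ζ]
  g l = fromℕ ((N ∸ j) C l) *ᶻ B̂ l

Σ-δ₁ : ∀ M (g : ℕ → ℚ[ζ]) → Σ (suc (suc M)) (λ j → g j *ᶻ δ₁ (suc M ∸ j)) ≡ g M
Σ-δ₁ zero    g = only-first (g 0) (g 1)
  where
  only-first : ∀ a b → a *ᶻ 1ᶻ +ᶻ (b *ᶻ 0ᶻ +ᶻ 0ᶻ) ≡ a
  only-first = solve-∀ ℚ[ζ]-ring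
Σ-δ₁ (suc M) g = begin
  g 0 *ᶻ 0ᶻ +ᶻ rest   ≡⟨ cong (_+ᶻ rest) (zeroʳ (g 0)) ⟩
  0ᶻ +ᶻ rest          ≡⟨ +ᶻ-identityˡ rest ⟩
  rest                ≡⟨ Σ-δ₁ M (g ∘ suc) ⟩
  g (suc M)           ∎
  where
  rest = Σ (suc (suc M)) (λ j → g (suc j) *ᶻ δ₁ (suc M ∸ j))

bernoulliForm-shift : ∀ M ρ w → bernoulliForm (suc M) ρ (w +ᶻ ρ) ≡ bernoulliForm (suc M) ρ w +ᶻ fromℕ (suc M) *ᶻ ρ *ᶻ w ^ᶻ M
bernoulliForm-shift M ρ w = begin
  Σ (suc N) (λ i → c i *ᶻ (w +ᶻ ρ) ^ᶻ i)
    ≡⟨ Σ-cong (suc N) (λ i i<1+N → trans (cong (c i *ᶻ_) (binomial-padded w ρ (ℕ.≤-pred i<1+N))) (Σ-*ˡ (suc N) (c i) (binomialTerm i w ρ))) ⟩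
  Σ (suc N) (λ i → Σ (suc N) (λ j → c i *ᶻ binomialTerm i w ρ j))
    ≡⟨ Σ-comm (suc N) (suc N) (λ i j → c i *ᶻ binomialTerm i w ρ j) ⟩
  Σ (suc N) (λ j → Σ (suc N) (λ i → c i *ᶻ binomialTerm i w ρ j))
    ≡⟨ Σ-cong (suc N) (λ j j<1+N → trans (Σ-cong (suc N) (λ i i<1+N →
         bernoulliCoeff-*-binomialTerm ρ w (ℕ.≤-pred i<1+N) (ℕ.≤-pred j<1+N))) (sym (Σ-*ˡ (suc N) (P j) (D j)))) ⟩
  Σ (suc N) (λ j → P j *ᶻ Σ (suc N) (D j))
    ≡⟨ Σ-cong (suc N) (λ j j<1+N → trans (cong (P j *ᶻ_) (Σ-column (ℕ.≤-pred j<1+N))) (*ᶻ-distribˡ _ _ _)) ⟩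
  Σ (suc N) (λ j → P j *ᶻ B̂ (N ∸ j) +ᶻ P j *ᶻ δ₁ (N ∸ j))
    ≡⟨ Σ-+ (suc N) (λ j → P j *ᶻ B̂ (N ∸ j)) (λ j → P j *ᶻ δ₁ (N ∸ j)) ⟩
  Σ (suc N) (λ j → P j *ᶻ B̂ (N ∸ j)) +ᶻ Σ (suc N) (λ j → P j *ᶻ δ₁ (N ∸ j))
    ≡⟨ cong₂ _+ᶻ_ (Σ-cong (suc N) (λ j _ → reorder j)) (trans (Σ-δ₁ M P) (binomialTerm-penultimate M w ρ)) ⟩
  bernoulliForm N ρ w +ᶻ fromℕ N *ᶻ ρ *ᶻ w ^ᶻ M
    ∎
  where
  N = suc M
  c = bernoulliCoeff N ρ
  P = binomialTerm N w ρ
  D : ℕ → ℕ → ℚ[ζ]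
  D j i = fromℕ ((N ∸ j) C (N ∸ i)) *ᶻ B̂ (N ∸ i)
  reorder : ∀ j → P j *ᶻ B̂ (N ∸ j) ≡ c j *ᶻ w ^ᶻ j
  reorder j = swap (fromℕ (N C j)) (w ^ᶻ j) (ρ ^ᶻ (N ∸ j)) (B̂ (N ∸ j))
    where
    swap : ∀ a x r b → a *ᶻ (x *ᶻ r) *ᶻ b ≡ a *ᶻ b *ᶻ r *ᶻ x
    swap = solve-∀ ℚ[ζ]-ring

sign : Bool → ℚ[ζ]
sign true  = 1ᶻ
sign false = -ᶻ 1ᶻ

Point : Set
Point = Bool × Bool × Bool × Bool

-- ω ε = (ε₀ + ε₁ ζ + ε₂ ζ² + ε₃ ζ³) / 2 for ε ∈ {±1}⁴, with true standing for +1.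
ω : Point → ℚ[ζ]
ω (a , b , c , d) = mk (half a) (half b) (half c) (half d)
  where
  half : Bool → ℚ
  half true  = ½
  half false = ℚ.- ½

χ : Point → ℚ[ζ]
χ (a , b , c , d) = sign a *ᶻ sign b *ᶻ sign c *ᶻ sign d

rotate : Point → Point
rotate (a , b , c , d) = not d , a , b , c

coord : Fin 4 → Point → Bool
coord 0F (a , _ , _ , _) = a
coord 1F (_ , b , _ , _) = b
coord 2F (_ , _ , c , _) = c
coord 3F (_ , _ , _ , d) = d

insert : Fin 4 → Bool → Bool → Bool → Bool → Point
insert 0F t x y z = t , x , y , z
insert 1F t x y z = x , t , y , z
insert 2F t x y z = x , y , t , z
insert 3F t x y z = x , y , z , t

coord-insert : ∀ i t x y z → coord i (insert i t x y z) ≡ t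
coord-insert 0F t x y z = refl
coord-insert 1F t x y z = refl
coord-insert 2F t x y z = refl
coord-insert 3F t x y z = refl

∑𝔹 : (Bool → ℚ[ζ]) → ℚ[ζ]
∑𝔹 g = g true +ᶻ g false

∑² : (Bool → Bool → ℚ[ζ]) → ℚ[ζ]
∑² f = ∑𝔹 λ a → ∑𝔹 (f a)

∑³ : (Bool → Bool → Bool → ℚ[ζ]) → ℚ[ζ]
∑³ f = ∑𝔹 λ a → ∑² (f a)

∑□ : (Point → ℚ[ζ]) → ℚ[ζ]
∑□ f = ∑³ λ a b c → ∑𝔹 λ d → f (a , b , c , d)

∑𝔹-cong : ∀ {g h} → (∀ b → g b ≡ h b) → ∑𝔹 g ≡ ∑𝔹 h
∑𝔹-cong g≗h = cong₂ _+ᶻ_ (g≗h true) (g≗h false)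

∑³-cong : ∀ {f g} → (∀ a b c → f a b c ≡ g a b c) → ∑³ f ≡ ∑³ g
∑³-cong f≗g = ∑𝔹-cong λ a → ∑𝔹-cong λ b → ∑𝔹-cong (f≗g a b)

∑□-cong : ∀ {f g} → (∀ p → f p ≡ g p) → ∑□ f ≡ ∑□ g
∑□-cong f≗g = ∑³-cong λ a b c → ∑𝔹-cong λ d → f≗g (a , b , c , d)

∑𝔹-+ : ∀ g h → ∑𝔹 (λ b → g b +ᶻ h b) ≡ ∑𝔹 g +ᶻ ∑𝔹 h
∑𝔹-+ g h = +ᶻ-interchange (g true) (h true) (g false) (h false)

∑²-+ : ∀ f g → ∑² (λ a b → f a b +ᶻ g a b) ≡ ∑² f +ᶻ ∑² g
∑²-+ f g = trans (∑𝔹-cong λ a → ∑𝔹-+ (f a) (g a)) (∑𝔹-+ (∑𝔹 ∘ f) (∑𝔹 ∘ g))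

∑³-+ : ∀ f g → ∑³ (λ a b c → f a b c +ᶻ g a b c) ≡ ∑³ f +ᶻ ∑³ g
∑³-+ f g = trans (∑𝔹-cong λ a → ∑²-+ (f a) (g a)) (∑𝔹-+ (∑² ∘ f) (∑² ∘ g))

∑□-+ : ∀ f g → ∑□ (λ p → f p +ᶻ g p) ≡ ∑□ f +ᶻ ∑□ g
∑□-+ f g = trans (∑³-cong λ a b c → ∑𝔹-+ (λ d → f (a , b , c , d)) (λ d → g (a , b , c , d)))
                 (∑³-+ (λ a b c → ∑𝔹 λ d → f (a , b , c , d)) (λ a b c → ∑𝔹 λ d → g (a , b , c , d)))

∑𝔹-*ˡ : ∀ x g → x *ᶻ ∑𝔹 g ≡ ∑𝔹 (λ b → x *ᶻ g b)
∑𝔹-*ˡ x g = *ᶻ-distribˡ x (g true) (g false)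

∑²-*ˡ : ∀ x f → x *ᶻ ∑² f ≡ ∑² (λ a b → x *ᶻ f a b)
∑²-*ˡ x f = trans (∑𝔹-*ˡ x (∑𝔹 ∘ f)) (∑𝔹-cong λ a → ∑𝔹-*ˡ x (f a))

∑³-*ˡ : ∀ x f → x *ᶻ ∑³ f ≡ ∑³ (λ a b c → x *ᶻ f a b c)
∑³-*ˡ x f = trans (∑𝔹-*ˡ x (∑² ∘ f)) (∑𝔹-cong λ a → ∑²-*ˡ x (f a))

∑□-*ˡ : ∀ x f → x *ᶻ ∑□ f ≡ ∑□ (λ p → x *ᶻ f p)
∑□-*ˡ x f = trans (∑³-*ˡ x (λ a b c → ∑𝔹 λ d → f (a , b , c , d)))
                  (∑³-cong λ a b c → ∑𝔹-*ˡ x (λ d → f (a , b , c , d)))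

∑𝔹-comm : ∀ (f : Bool → Bool → ℚ[ζ]) → ∑𝔹 (λ a → ∑𝔹 (f a)) ≡ ∑𝔹 (λ b → ∑𝔹 (λ a → f a b))
∑𝔹-comm f = sym (∑𝔹-+ (f true) (f false))

∑𝔹-not : ∀ g → ∑𝔹 (g ∘ not) ≡ ∑𝔹 g
∑𝔹-not g = +ᶻ-comm (g false) (g true)

∑□-insert : ∀ i f → ∑□ f ≡ ∑³ (λ x y z → ∑𝔹 λ t → f (insert i t x y z))
∑□-insert 0F f = trans (∑𝔹-comm (λ a b → ∑² λ c d → f (a , b , c , d))) (∑𝔹-cong λ b →
                   trans (∑𝔹-comm (λ a c → ∑𝔹 λ d → f (a , b , c , d))) (∑𝔹-cong λ c → ∑𝔹-comm (λ a d → f (a , b , c , d))))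
∑□-insert 1F f = ∑𝔹-cong λ a → trans (∑𝔹-comm (λ b c → ∑𝔹 λ d → f (a , b , c , d))) (∑𝔹-cong λ c → ∑𝔹-comm (λ b d → f (a , b , c , d)))
∑□-insert 2F f = ∑𝔹-cong λ a → ∑𝔹-cong λ b → ∑𝔹-comm (λ c d → f (a , b , c , d))
∑□-insert 3F f = refl

∑□-rotate : ∀ f → ∑□ (f ∘ rotate) ≡ ∑□ f
∑□-rotate f = sym (trans (∑□-insert 0F f) (∑³-cong λ a b c → sym (∑𝔹-not (λ t → f (t , a , b , c)))))

∑□-Σ : ∀ n (f : ℕ → Point → ℚ[ζ]) → ∑□ (λ p → Σ n (λ i → f i p)) ≡ Σ n (λ i → ∑□ (f i))
∑□-Σ zero    f = refl
∑□-Σ (suc n) f = trans (∑□-+ (f 0) (λ p → Σ n (λ i → f (suc i) p))) (cong (∑□ (f 0) +ᶻ_) (∑□-Σ n (f ∘ suc)))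

∑□-∑ : ∀ {n} (f : Fin n → Point → ℚ[ζ]) → ∑□ (λ p → ∑[ i < n ] f i p) ≡ ∑[ i < n ] ∑□ (f i)
∑□-∑ {zero}  f = refl
∑□-∑ {suc n} f = trans (∑□-+ (f 0F) (λ p → ∑[ i < n ] f (Fin.suc i) p)) (cong (∑□ (f 0F) +ᶻ_) (∑□-∑ (f ∘ Fin.suc)))

∀𝔹? : {P : Bool → Set} → (∀ b → Dec (P b)) → Dec (∀ b → P b)
∀𝔹? P? = map′ (λ (pt , pf) → λ { true → pt ; false → pf }) (λ ∀P → ∀P true , ∀P false) (P? true ×-dec P? false)

∀□? : {P : Point → Set} → (∀ p → Dec (P p)) → Dec (∀ p → P p)
∀□? P? = map′ (λ ∀P (a , b , c , d) → ∀P a b c d) (λ ∀P a b c d → ∀P (a , b , c , d))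
              (∀𝔹? λ a → ∀𝔹? λ b → ∀𝔹? λ c → ∀𝔹? λ d → P? (a , b , c , d))

ζ*ω : ∀ p → ζ *ᶻ ω p ≡ ω (rotate p)
ζ*ω = from-yes (∀□? λ p → ζ *ᶻ ω p ≟ᶻ ω (rotate p))

χ-rotate : ∀ p → χ p ≡ -ᶻ χ (rotate p)
χ-rotate = from-yes (∀□? λ p → χ p ≟ᶻ -ᶻ χ (rotate p))

χ-involutive : ∀ p → χ p *ᶻ χ p ≡ 1ᶻ
χ-involutive = from-yes (∀□? λ p → χ p *ᶻ χ p ≟ᶻ 1ᶻ)

ω-insert : ∀ i x y z → ω (insert i true x y z) ≡ ω (insert i false x y z) +ᶻ ζ ^ᶻ toℕ i
ω-insert = from-yes (Fin.all? λ i → ∀𝔹? λ x → ∀𝔹? λ y → ∀𝔹? λ z →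
             ω (insert i true x y z) ≟ᶻ ω (insert i false x y z) +ᶻ ζ ^ᶻ toℕ i)

χ-insert : ∀ i x y z → χ (insert i false x y z) ≡ -ᶻ χ (insert i true x y z)
χ-insert = from-yes (Fin.all? λ i → ∀𝔹? λ x → ∀𝔹? λ y → ∀𝔹? λ z → χ (insert i false x y z) ≟ᶻ -ᶻ χ (insert i true x y z))

ω-from-coords : ∀ p → ∑[ i < 4 ] (ζ ^ᶻ toℕ i *ᶻ sign (coord i p)) ≡ fromℕ 2 *ᶻ ω p
ω-from-coords = from-yes (∀□? λ p → ∑[ i < 4 ] (ζ ^ᶻ toℕ i *ᶻ sign (coord i p)) ≟ᶻ fromℕ 2 *ᶻ ω p)

σ : ℕ → ℚ[ζ]
σ j = ∑□ (λ p → χ p *ᶻ ω p ^ᶻ j)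

ζ^j*σ : ∀ j → ζ ^ᶻ j *ᶻ σ j ≡ -ᶻ σ j
ζ^j*σ j = begin
  ζ ^ᶻ j *ᶻ σ j                          ≡⟨ ∑□-*ˡ (ζ ^ᶻ j) term ⟩
  ∑□ (λ p → ζ ^ᶻ j *ᶻ term p)            ≡⟨ ∑□-cong rotated ⟩
  ∑□ (λ p → (-ᶻ 1ᶻ) *ᶻ term (rotate p))  ≡⟨ sym (∑□-*ˡ (-ᶻ 1ᶻ) (term ∘ rotate)) ⟩
  (-ᶻ 1ᶻ) *ᶻ ∑□ (term ∘ rotate)          ≡⟨ cong ((-ᶻ 1ᶻ) *ᶻ_) (∑□-rotate term) ⟩
  (-ᶻ 1ᶻ) *ᶻ σ j                         ≡⟨ sym (-ᶻ-as-* (σ j)) ⟩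
  -ᶻ σ j                                 ∎
  where
  term : Point → ℚ[ζ]
  term p = χ p *ᶻ ω p ^ᶻ j
  rotated : ∀ p → ζ ^ᶻ j *ᶻ term p ≡ (-ᶻ 1ᶻ) *ᶻ term (rotate p)
  rotated p = begin
    ζ ^ᶻ j *ᶻ (χ p *ᶻ ω p ^ᶻ j)                  ≡⟨ x∙yz≈y∙xz (ζ ^ᶻ j) (χ p) (ω p ^ᶻ j) ⟩
    χ p *ᶻ (ζ ^ᶻ j *ᶻ ω p ^ᶻ j)                  ≡⟨ cong (χ p *ᶻ_) (sym (^-distrib-* ζ (ω p) j)) ⟩
    χ p *ᶻ (ζ *ᶻ ω p) ^ᶻ j                       ≡⟨ cong₂ (λ s w → s *ᶻ w ^ᶻ j) (χ-rotate p) (ζ*ω p) ⟩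
    -ᶻ χ (rotate p) *ᶻ ω (rotate p) ^ᶻ j         ≡⟨ -ᶻ-*-assoc (χ (rotate p)) (ω (rotate p) ^ᶻ j) ⟩
    (-ᶻ 1ᶻ) *ᶻ term (rotate p)                   ∎
    where
    -ᶻ-*-assoc : ∀ x y → -ᶻ x *ᶻ y ≡ (-ᶻ 1ᶻ) *ᶻ (x *ᶻ y)
    -ᶻ-*-assoc = solve-∀ ℚ[ζ]-ring

ζ⁴≡-1 : ζ ^ᶻ 4 ≡ -ᶻ 1ᶻ
ζ⁴≡-1 = refl

ζ^[4+r] : ∀ r → ζ ^ᶻ (4 + r) ≡ -ᶻ ζ ^ᶻ r
ζ^[4+r] r = trans (^-homo-* ζ 4 r) (trans (cong (_*ᶻ ζ ^ᶻ r) ζ⁴≡-1) (sym (-ᶻ-as-* (ζ ^ᶻ r))))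

ζ^[8q]≡1 : ∀ q → ζ ^ᶻ (8 * q) ≡ 1ᶻ
ζ^[8q]≡1 q = begin
  ζ ^ᶻ (8 * q)              ≡⟨ cong (ζ ^ᶻ_) (ℕ.*-assoc 4 2 q) ⟩
  ζ ^ᶻ (4 * (2 * q))        ≡⟨ sym (^-assocʳ ζ 4 (2 * q)) ⟩
  (ζ ^ᶻ 4) ^ᶻ (2 * q)       ≡⟨ cong (_^ᶻ (2 * q)) ζ⁴≡-1 ⟩
  (-ᶻ 1ᶻ) ^ᶻ (2 * q)        ≡⟨ sym (^-assocʳ (-ᶻ 1ᶻ) 2 q) ⟩
  ((-ᶻ 1ᶻ) ^ᶻ 2) ^ᶻ q       ≡⟨ 1ᶻ^ q ⟩
  1ᶻ                        ∎

ζ-periodic : ∀ q r → ζ ^ᶻ (q * 8 + r) ≡ ζ ^ᶻ r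
ζ-periodic q r = begin
  ζ ^ᶻ (q * 8 + r)            ≡⟨ ^-homo-* ζ (q * 8) r ⟩
  ζ ^ᶻ (q * 8) *ᶻ ζ ^ᶻ r      ≡⟨ cong (λ e → ζ ^ᶻ e *ᶻ ζ ^ᶻ r) (ℕ.*-comm q 8) ⟩
  ζ ^ᶻ (8 * q) *ᶻ ζ ^ᶻ r      ≡⟨ cong (_*ᶻ ζ ^ᶻ r) (ζ^[8q]≡1 q) ⟩
  1ᶻ *ᶻ ζ ^ᶻ r                ≡⟨ *ᶻ-identityˡ (ζ ^ᶻ r) ⟩
  ζ ^ᶻ r                      ∎

unit-annihilates : ∀ {u z x} → u *ᶻ (1ᶻ +ᶻ z) ≡ 1ᶻ → z *ᶻ x ≡ -ᶻ x → x ≡ 0ᶻ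
unit-annihilates {u} {z} {x} u*[1+z]≡1 zx≡-x = begin
  x                        ≡⟨ sym (*ᶻ-identityˡ x) ⟩
  1ᶻ *ᶻ x                  ≡⟨ cong (_*ᶻ x) (sym u*[1+z]≡1) ⟩
  u *ᶻ (1ᶻ +ᶻ z) *ᶻ x      ≡⟨ solve (u ∷ z ∷ x ∷ []) ℚ[ζ]-ring ⟩
  u *ᶻ (x +ᶻ z *ᶻ x)       ≡⟨ cong (λ y → u *ᶻ (x +ᶻ y)) zx≡-x ⟩
  u *ᶻ (x +ᶻ -ᶻ x)         ≡⟨ solve (u ∷ x ∷ []) ℚ[ζ]-ring ⟩
  0ᶻ                       ∎

-- With w = ±ζʳ the inverse of 1 − w comes from 1 − w⁴ = 2 (r odd) or 1 − w² = 2 (r = 2).  Residues r > 4 are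
-- reduced through ζʳ = −ζʳ⁻⁴: evaluating ζʳ by normalisation costs time exponential in r.
1-ζʳ-invertible : ∀ (r : Fin 4) → r ≢ 0F → ∃ λ u → u *ᶻ (1ᶻ +ᶻ -ᶻ ζ ^ᶻ toℕ r) ≡ 1ᶻ
1-ζʳ-invertible 0F 0≢0 = contradiction refl 0≢0
1-ζʳ-invertible 1F _   = mk ½ ½ ½ ½ , refl
1-ζʳ-invertible 2F _   = mk ½ 0ℚ ½ 0ℚ , refl
1-ζʳ-invertible 3F _   = mk ½ ½ (ℚ.- ½) ½ , refl

1+ζʳ-invertible : ∀ (r : Fin 8) → r ≢ 4F → ∃ λ u → u *ᶻ (1ᶻ +ᶻ ζ ^ᶻ toℕ r) ≡ 1ᶻ
1+ζʳ-invertible 0F _ = mk ½ 0ℚ 0ℚ 0ℚ , refl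
1+ζʳ-invertible 1F _ = mk ½ (ℚ.- ½) ½ (ℚ.- ½) , refl
1+ζʳ-invertible 2F _ = mk ½ 0ℚ (ℚ.- ½) 0ℚ , refl
1+ζʳ-invertible 3F _ = mk ½ (ℚ.- ½) (ℚ.- ½) (ℚ.- ½) , refl
1+ζʳ-invertible (Fin.suc (Fin.suc (Fin.suc (Fin.suc r)))) r+4≢4
  with 1-ζʳ-invertible r (λ r≡0 → r+4≢4 (cong (Fin.suc ∘ Fin.suc ∘ Fin.suc ∘ Fin.suc) r≡0))
... | u , u*[1-ζʳ]≡1 = u , subst (λ z → u *ᶻ (1ᶻ +ᶻ z) ≡ 1ᶻ) (sym (ζ^[4+r] (toℕ r))) u*[1-ζʳ]≡1

σ-vanishes : ∀ q (r : Fin 8) → r ≢ 4F → σ (q * 8 + toℕ r) ≡ 0ᶻ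
σ-vanishes q r r≢4 with 1+ζʳ-invertible r r≢4
... | u , u*[1+ζʳ]≡1 =
  unit-annihilates (trans (cong (λ z → u *ᶻ (1ᶻ +ᶻ z)) (ζ-periodic q (toℕ r))) u*[1+ζʳ]≡1) (ζ^j*σ (q * 8 + toℕ r))

-- X = 1 + 1/√2 and Y = 1 − 1/√2, with √2 = ζ − ζ³; κ = −ζ².
X Y κ : ℚ[ζ]
X = mk 1ℚ ½ 0ℚ (ℚ.- ½)
Y = mk 1ℚ (ℚ.- ½) 0ℚ ½
κ = mk 0ℚ 0ℚ (ℚ.- 1ℚ) 0ℚ

A : ℕ → ℚ[ζ]
A m = X ^ᶻ m +ᶻ Y ^ᶻ m

-- χ ω⁴ equals κ X² on the rotation orbit of (1, 1, 1, 1) and κ Y² on the other eight points.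
∑□-χω⁴ : ∀ (g : ℚ[ζ] → ℚ[ζ]) → ∑□ (λ p → g (χ p *ᶻ ω p ^ᶻ 4)) ≡ fromℕ 8 *ᶻ (g (κ *ᶻ X ^ᶻ 2) +ᶻ g (κ *ᶻ Y ^ᶻ 2))
∑□-χω⁴ g = eight-each (g (κ *ᶻ X ^ᶻ 2)) (g (κ *ᶻ Y ^ᶻ 2))
  where
  eight-each : ∀ u v → u +ᶻ u +ᶻ (v +ᶻ u) +ᶻ (v +ᶻ v +ᶻ (v +ᶻ u)) +ᶻ (u +ᶻ v +ᶻ (v +ᶻ v) +ᶻ (u +ᶻ v +ᶻ (u +ᶻ u)))
                       ≡ fromℕ 8 *ᶻ (u +ᶻ v)
  eight-each = solve-∀ ℚ[ζ]-ring

oddPower : ℕ → ℚ[ζ] → ℚ[ζ]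
oddPower q t = t *ᶻ (t ^ᶻ 2) ^ᶻ q

t*w^[8q+4] : ∀ q t w → t *ᶻ t ≡ 1ᶻ → t *ᶻ w ^ᶻ (q * 8 + 4) ≡ oddPower q (t *ᶻ w ^ᶻ 4)
t*w^[8q+4] q t w t²≡1 = begin
  t *ᶻ w ^ᶻ (q * 8 + 4)                              ≡⟨ cong (t *ᶻ_) (^-homo-* w (q * 8) 4) ⟩
  t *ᶻ (w ^ᶻ (q * 8) *ᶻ w ^ᶻ 4)                      ≡⟨ cong (λ p → t *ᶻ (p *ᶻ w ^ᶻ 4)) w^[8q] ⟩
  t *ᶻ ((w ^ᶻ 8) ^ᶻ q *ᶻ w ^ᶻ 4)                     ≡⟨ cong (λ p → t *ᶻ (p ^ᶻ q *ᶻ w ^ᶻ 4)) w⁸ ⟩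
  t *ᶻ (((t *ᶻ w ^ᶻ 4) ^ᶻ 2) ^ᶻ q *ᶻ w ^ᶻ 4)        ≡⟨ regroup t (((t *ᶻ w ^ᶻ 4) ^ᶻ 2) ^ᶻ q) (w ^ᶻ 4) ⟩
  oddPower q (t *ᶻ w ^ᶻ 4)                           ∎
  where
  regroup : ∀ x p y → x *ᶻ (p *ᶻ y) ≡ x *ᶻ y *ᶻ p
  regroup = solve-∀ ℚ[ζ]-ring
  w^[8q] : w ^ᶻ (q * 8) ≡ (w ^ᶻ 8) ^ᶻ q
  w^[8q] = trans (cong (w ^ᶻ_) (ℕ.*-comm q 8)) (sym (^-assocʳ w 8 q))
  w⁸ : w ^ᶻ 8 ≡ (t *ᶻ w ^ᶻ 4) ^ᶻ 2
  w⁸ = sym (begin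
    (t *ᶻ w ^ᶻ 4) ^ᶻ 2          ≡⟨ ^-distrib-* t (w ^ᶻ 4) 2 ⟩
    t ^ᶻ 2 *ᶻ (w ^ᶻ 4) ^ᶻ 2     ≡⟨ cong₂ _*ᶻ_ (trans (cong (t *ᶻ_) (*ᶻ-identityʳ t)) t²≡1) (^-assocʳ w 4 2) ⟩
    1ᶻ *ᶻ w ^ᶻ 8                ≡⟨ *ᶻ-identityˡ (w ^ᶻ 8) ⟩
    w ^ᶻ 8                      ∎)

κZ²-power : ∀ q Z → oddPower q (κ *ᶻ Z ^ᶻ 2) ≡ κ *ᶻ ((-ᶻ 1ᶻ) ^ᶻ q *ᶻ Z ^ᶻ (4 * q + 2))
κZ²-power q Z = begin
  κ *ᶻ Z ^ᶻ 2 *ᶻ ((κ *ᶻ Z ^ᶻ 2) ^ᶻ 2) ^ᶻ q     ≡⟨ cong (λ p → κ *ᶻ Z ^ᶻ 2 *ᶻ p ^ᶻ q) square ⟩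
  κ *ᶻ Z ^ᶻ 2 *ᶻ ((-ᶻ 1ᶻ) *ᶻ Z ^ᶻ 4) ^ᶻ q      ≡⟨ cong (κ *ᶻ Z ^ᶻ 2 *ᶻ_) (^-distrib-* (-ᶻ 1ᶻ) (Z ^ᶻ 4) q) ⟩
  κ *ᶻ Z ^ᶻ 2 *ᶻ (s *ᶻ (Z ^ᶻ 4) ^ᶻ q)          ≡⟨ cong (λ p → κ *ᶻ Z ^ᶻ 2 *ᶻ (s *ᶻ p)) (^-assocʳ Z 4 q) ⟩
  κ *ᶻ Z ^ᶻ 2 *ᶻ (s *ᶻ Z ^ᶻ (4 * q))           ≡⟨ regroup κ (Z ^ᶻ 2) s (Z ^ᶻ (4 * q)) ⟩
  κ *ᶻ (s *ᶻ (Z ^ᶻ (4 * q) *ᶻ Z ^ᶻ 2))         ≡⟨ cong (λ p → κ *ᶻ (s *ᶻ p)) (sym (^-homo-* Z (4 * q) 2)) ⟩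
  κ *ᶻ (s *ᶻ Z ^ᶻ (4 * q + 2))                 ∎
  where
  s = (-ᶻ 1ᶻ) ^ᶻ q
  regroup : ∀ k z s p → k *ᶻ z *ᶻ (s *ᶻ p) ≡ k *ᶻ (s *ᶻ (p *ᶻ z))
  regroup = solve-∀ ℚ[ζ]-ring
  square : (κ *ᶻ Z ^ᶻ 2) ^ᶻ 2 ≡ (-ᶻ 1ᶻ) *ᶻ Z ^ᶻ 4
  square = trans (^-distrib-* κ (Z ^ᶻ 2) 2) (cong (κ ^ᶻ 2 *ᶻ_) (^-assocʳ Z 2 2))

σ-8q+4 : ∀ q → σ (q * 8 + 4) ≡ fromℕ 8 *ᶻ (κ *ᶻ ((-ᶻ 1ᶻ) ^ᶻ q *ᶻ A (4 * q + 2)))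
σ-8q+4 q = begin
  σ (q * 8 + 4)                                                  ≡⟨ ∑□-cong (λ p → t*w^[8q+4] q (χ p) (ω p) (χ-involutive p)) ⟩
  ∑□ (λ p → oddPower q (χ p *ᶻ ω p ^ᶻ 4))                       ≡⟨ ∑□-χω⁴ (oddPower q) ⟩
  fromℕ 8 *ᶻ (oddPower q (κ *ᶻ X ^ᶻ 2) +ᶻ oddPower q (κ *ᶻ Y ^ᶻ 2)) ≡⟨ cong₂ (λ x y → fromℕ 8 *ᶻ (x +ᶻ y)) (κZ²-power q X) (κZ²-power q Y) ⟩
  fromℕ 8 *ᶻ (κ *ᶻ (s *ᶻ X ^ᶻ e) +ᶻ κ *ᶻ (s *ᶻ Y ^ᶻ e))          ≡⟨ cong (fromℕ 8 *ᶻ_) (factor κ s (X ^ᶻ e) (Y ^ᶻ e)) ⟩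
  fromℕ 8 *ᶻ (κ *ᶻ (s *ᶻ A e))                                   ∎
  where
  s = (-ᶻ 1ᶻ) ^ᶻ q
  e = 4 * q + 2
  factor : ∀ k s x y → k *ᶻ (s *ᶻ x) +ᶻ k *ᶻ (s *ᶻ y) ≡ k *ᶻ (s *ᶻ (x +ᶻ y))
  factor = solve-∀ ℚ[ζ]-ring

L : ℕ → ℚ[ζ] → ℚ[ζ]
L N ρ = ∑□ (λ p → χ p *ᶻ bernoulliForm N ρ (ω p))

L-expand : ∀ N ρ → L N ρ ≡ Σ (suc N) (λ i → bernoulliCoeff N ρ i *ᶻ σ i)
L-expand N ρ = begin
  ∑□ (λ p → χ p *ᶻ Σ (suc N) (λ i → c i *ᶻ ω p ^ᶻ i))        ≡⟨ ∑□-cong (λ p → trans (Σ-*ˡ (suc N) (χ p) (λ i → c i *ᶻ ω p ^ᶻ i))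
                                                                   (Σ-cong (suc N) (λ i _ → x∙yz≈y∙xz (χ p) (c i) (ω p ^ᶻ i)))) ⟩
  ∑□ (λ p → Σ (suc N) (λ i → c i *ᶻ (χ p *ᶻ ω p ^ᶻ i)))     ≡⟨ ∑□-Σ (suc N) (λ i p → c i *ᶻ (χ p *ᶻ ω p ^ᶻ i)) ⟩
  Σ (suc N) (λ i → ∑□ (λ p → c i *ᶻ (χ p *ᶻ ω p ^ᶻ i)))     ≡⟨ Σ-cong (suc N) (λ i _ → sym (∑□-*ˡ (c i) (λ p → χ p *ᶻ ω p ^ᶻ i))) ⟩
  Σ (suc N) (λ i → c i *ᶻ σ i)                               ∎
  where
  c = bernoulliCoeff N ρ

γ : ℕ → ℕ → ℚ[ζ]
γ n k = fromℕ ((8 * n + 4) C (8 * k + 4)) *ᶻ B̂ (8 * n ∸ 8 * k)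

T : ℕ → ℚ[ζ]
T n = Σ (suc n) (λ q → γ n q *ᶻ σ (q * 8 + 4))

^[8k]≡1 : ∀ {ρ} k → ρ ^ᶻ 8 ≡ 1ᶻ → ρ ^ᶻ (8 * k) ≡ 1ᶻ
^[8k]≡1 {ρ} k ρ⁸≡1 = begin
  ρ ^ᶻ (8 * k)       ≡⟨ sym (^-assocʳ ρ 8 k) ⟩
  (ρ ^ᶻ 8) ^ᶻ k      ≡⟨ cong (_^ᶻ k) ρ⁸≡1 ⟩
  1ᶻ ^ᶻ k            ≡⟨ 1ᶻ^ k ⟩
  1ᶻ                 ∎

bernoulliCoeff-vanishes : ∀ {N i} ρ → N < i → bernoulliCoeff N ρ i ≡ 0ᶻ
bernoulliCoeff-vanishes {N} {i} ρ N<i = begin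
  fromℕ (N C i) *ᶻ B̂ (N ∸ i) *ᶻ ρ ^ᶻ (N ∸ i)   ≡⟨ cong (λ k → fromℕ k *ᶻ B̂ (N ∸ i) *ᶻ ρ ^ᶻ (N ∸ i)) (k>n⇒nCk≡0 N<i) ⟩
  0ᶻ *ᶻ B̂ (N ∸ i) *ᶻ ρ ^ᶻ (N ∸ i)              ≡⟨ annihilate (B̂ (N ∸ i)) (ρ ^ᶻ (N ∸ i)) ⟩
  0ᶻ                                           ∎
  where
  annihilate : ∀ x y → 0ᶻ *ᶻ x *ᶻ y ≡ 0ᶻ
  annihilate = solve-∀ ℚ[ζ]-ring

[8n+4]∸[8q+4] : ∀ n q → 8 * n + 4 ∸ (q * 8 + 4) ≡ 8 * n ∸ 8 * q
[8n+4]∸[8q+4] n q = begin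
  8 * n + 4 ∸ (q * 8 + 4)   ≡⟨ cong₂ _∸_ (ℕ.+-comm (8 * n) 4) (ℕ.+-comm (q * 8) 4) ⟩
  4 + 8 * n ∸ (4 + q * 8)   ≡⟨ ℕ.[m+n]∸[m+o]≡n∸o 4 (8 * n) (q * 8) ⟩
  8 * n ∸ q * 8             ≡⟨ cong (8 * n ∸_) (ℕ.*-comm q 8) ⟩
  8 * n ∸ 8 * q             ∎

8n+4<8[n+1] : ∀ n → suc (8 * n + 4) ≤ suc n * 8
8n+4<8[n+1] n = subst₂ _≤_ (ℕ.+-suc (8 * n) 4) (trans (ℕ.+-comm (8 * n) 8) (cong (λ k → 8 + k) (ℕ.*-comm 8 n)))
                  (ℕ.+-monoʳ-≤ (8 * n) (ℕ.m≤m+n 5 3))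

L-collapse : ∀ n {ρ} → ρ ^ᶻ 8 ≡ 1ᶻ → L (8 * n + 4) ρ ≡ T n
L-collapse n {ρ} ρ⁸≡1 = begin
  L N ρ                                           ≡⟨ L-expand N ρ ⟩
  Σ (suc N) f                                     ≡⟨ sym (Σ-extend {suc N} {suc n * 8} f (8n+4<8[n+1] n) (λ i N<i →
                                                       trans (cong (_*ᶻ σ i) (bernoulliCoeff-vanishes ρ N<i)) (zeroˡ (σ i)))) ⟩
  Σ (suc n * 8) f                                 ≡⟨ Σ-blocks (suc n) 8 f ⟩
  Σ (suc n) (λ q → Σ 8 (λ r → f (q * 8 + r)))     ≡⟨ Σ-cong (suc n) (λ q _ → Σ-single 7 {λ r → f (q * 8 + r)} 4F λ r r≢4 →
                                                       trans (cong (c (q * 8 + toℕ r) *ᶻ_) (σ-vanishes q r r≢4)) (zeroʳ _)) ⟩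
  Σ (suc n) (λ q → f (q * 8 + 4))                 ≡⟨ Σ-cong (suc n) (λ q _ → block-term q) ⟩
  T n                                             ∎
  where
  N = 8 * n + 4
  c = bernoulliCoeff N ρ
  f : ℕ → ℚ[ζ]
  f i = c i *ᶻ σ i
  block-term : ∀ q → f (q * 8 + 4) ≡ γ n q *ᶻ σ (q * 8 + 4)
  block-term q = begin
    fromℕ (N C (q * 8 + 4)) *ᶻ B̂ (N ∸ (q * 8 + 4)) *ᶻ ρ ^ᶻ (N ∸ (q * 8 + 4)) *ᶻ σ (q * 8 + 4)
      ≡⟨ cong₂ (λ k e → fromℕ (N C k) *ᶻ B̂ e *ᶻ ρ ^ᶻ e *ᶻ σ (q * 8 + 4)) (cong (_+ 4) (ℕ.*-comm q 8)) ([8n+4]∸[8q+4] n q) ⟩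
    fromℕ (N C (8 * q + 4)) *ᶻ B̂ (8 * n ∸ 8 * q) *ᶻ ρ ^ᶻ (8 * n ∸ 8 * q) *ᶻ σ (q * 8 + 4)
      ≡⟨ cong (λ r → fromℕ (N C (8 * q + 4)) *ᶻ B̂ (8 * n ∸ 8 * q) *ᶻ r *ᶻ σ (q * 8 + 4))
              (trans (cong (ρ ^ᶻ_) (sym (ℕ.*-distribˡ-∸ 8 n q))) (^[8k]≡1 (n ∸ q) ρ⁸≡1)) ⟩
    fromℕ (N C (8 * q + 4)) *ᶻ B̂ (8 * n ∸ 8 * q) *ᶻ 1ᶻ *ᶻ σ (q * 8 + 4)
      ≡⟨ cong (_*ᶻ σ (q * 8 + 4)) (*ᶻ-identityʳ _) ⟩
    fromℕ (N C (8 * q + 4)) *ᶻ B̂ (8 * n ∸ 8 * q) *ᶻ σ (q * 8 + 4)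
      ∎

paired-fibre : ∀ M ρ (w c : Bool → ℚ[ζ]) → w true ≡ w false +ᶻ ρ → c false ≡ -ᶻ c true →
  ∑𝔹 (λ t → c t *ᶻ (bernoulliForm (suc M) ρ (w t) +ᶻ bernoulliForm (suc M) (-ᶻ ρ) (w t)))
    ≡ fromℕ (suc M) *ᶻ ρ *ᶻ ∑𝔹 (λ t → sign t *ᶻ c t *ᶻ w t ^ᶻ M)
paired-fibre M ρ w c w₊≡w₋+ρ c₋≡-c₊ = begin
  c true *ᶻ (Q ρ w₊ +ᶻ Q (-ᶻ ρ) w₊) +ᶻ c false *ᶻ (Q ρ w₋ +ᶻ Q (-ᶻ ρ) w₋)  ≡⟨ cong₂ (λ x y → c true *ᶻ (x +ᶻ Q (-ᶻ ρ) w₊) +ᶻ c false *ᶻ (Q ρ w₋ +ᶻ y))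
                                                                              shift₊ shift₋ ⟩
  E (c false)                                                              ≡⟨ cong E c₋≡-c₊ ⟩
  E (-ᶻ c true)                                                            ≡⟨ telescope (fromℕ (suc M)) ρ (c true) (Q ρ w₋) (Q (-ᶻ ρ) w₊) (w₊ ^ᶻ M) (w₋ ^ᶻ M) ⟩
  R (-ᶻ c true)                                                            ≡⟨ cong R (sym c₋≡-c₊) ⟩
  R (c false)                                                              ∎
  where
  Q = bernoulliForm (suc M)
  w₊ = w true
  w₋ = w false
  shift₊ : Q ρ w₊ ≡ Q ρ w₋ +ᶻ fromℕ (suc M) *ᶻ ρ *ᶻ w₋ ^ᶻ M
  shift₊ = trans (cong (Q ρ) w₊≡w₋+ρ) (bernoulliForm-shift M ρ w₋)
  w₋≡w₊-ρ : w₋ ≡ w₊ +ᶻ -ᶻ ρ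
  w₋≡w₊-ρ = trans (cancel-ρ w₋ ρ) (cong (_+ᶻ -ᶻ ρ) (sym w₊≡w₋+ρ))
    where
    cancel-ρ : ∀ x r → x ≡ x +ᶻ r +ᶻ -ᶻ r
    cancel-ρ = solve-∀ ℚ[ζ]-ring
  shift₋ : Q (-ᶻ ρ) w₋ ≡ Q (-ᶻ ρ) w₊ +ᶻ fromℕ (suc M) *ᶻ (-ᶻ ρ) *ᶻ w₊ ^ᶻ M
  shift₋ = trans (cong (Q (-ᶻ ρ)) w₋≡w₊-ρ) (bernoulliForm-shift M (-ᶻ ρ) w₊)
  E R : ℚ[ζ] → ℚ[ζ]
  E s = c true *ᶻ (Q ρ w₋ +ᶻ fromℕ (suc M) *ᶻ ρ *ᶻ w₋ ^ᶻ M +ᶻ Q (-ᶻ ρ) w₊)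
          +ᶻ s *ᶻ (Q ρ w₋ +ᶻ (Q (-ᶻ ρ) w₊ +ᶻ fromℕ (suc M) *ᶻ (-ᶻ ρ) *ᶻ w₊ ^ᶻ M))
  R s = fromℕ (suc M) *ᶻ ρ *ᶻ (sign true *ᶻ c true *ᶻ w₊ ^ᶻ M +ᶻ sign false *ᶻ s *ᶻ w₋ ^ᶻ M)
  telescope : ∀ n r c q₊ q₋ a b →
    c *ᶻ (q₊ +ᶻ n *ᶻ r *ᶻ b +ᶻ q₋) +ᶻ (-ᶻ c) *ᶻ (q₊ +ᶻ (q₋ +ᶻ n *ᶻ (-ᶻ r) *ᶻ a))
      ≡ n *ᶻ r *ᶻ (1ᶻ *ᶻ c *ᶻ a +ᶻ (-ᶻ 1ᶻ) *ᶻ (-ᶻ c) *ᶻ b)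
  telescope = solve-∀ ℚ[ζ]-ring

L-pair : ∀ M i → L (suc M) (ζ ^ᶻ toℕ i) +ᶻ L (suc M) (-ᶻ ζ ^ᶻ toℕ i)
                   ≡ fromℕ (suc M) *ᶻ ζ ^ᶻ toℕ i *ᶻ ∑□ (λ p → sign (coord i p) *ᶻ χ p *ᶻ ω p ^ᶻ M)
L-pair M i = begin
  L (suc M) ρ +ᶻ L (suc M) (-ᶻ ρ)                                ≡⟨ sym (∑□-+ (λ p → χ p *ᶻ Q ρ (ω p)) (λ p → χ p *ᶻ Q (-ᶻ ρ) (ω p))) ⟩
  ∑□ (λ p → χ p *ᶻ Q ρ (ω p) +ᶻ χ p *ᶻ Q (-ᶻ ρ) (ω p))          ≡⟨ ∑□-cong (λ p → sym (*ᶻ-distribˡ (χ p) (Q ρ (ω p)) (Q (-ᶻ ρ) (ω p)))) ⟩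
  ∑□ F                                                           ≡⟨ ∑□-insert i F ⟩
  ∑³ (λ x y z → ∑𝔹 λ t → F (insert i t x y z))                  ≡⟨ ∑³-cong (λ x y z → paired-fibre M ρ (λ t → ω (insert i t x y z))
                                                                       (λ t → χ (insert i t x y z)) (ω-insert i x y z) (χ-insert i x y z)) ⟩
  ∑³ (λ x y z → Nρ *ᶻ ∑𝔹 λ t → G′ t (insert i t x y z))          ≡⟨ sym (∑³-*ˡ Nρ (λ x y z → ∑𝔹 λ t → G′ t (insert i t x y z))) ⟩
  Nρ *ᶻ ∑³ (λ x y z → ∑𝔹 λ t → G′ t (insert i t x y z))          ≡⟨ cong (Nρ *ᶻ_) (sym (trans (∑□-insert i G) (∑³-cong λ x y z → ∑𝔹-cong λ t →
                                                                       cong (λ b → G′ b (insert i t x y z)) (coord-insert i t x y z)))) ⟩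
  Nρ *ᶻ ∑□ G                                                     ∎
  where
  ρ = ζ ^ᶻ toℕ i
  Q = bernoulliForm (suc M)
  Nρ = fromℕ (suc M) *ᶻ ρ
  F G : Point → ℚ[ζ]
  F p = χ p *ᶻ (Q ρ (ω p) +ᶻ Q (-ᶻ ρ) (ω p))
  G p = sign (coord i p) *ᶻ χ p *ᶻ ω p ^ᶻ M
  G′ : Bool → Point → ℚ[ζ]
  G′ t p = sign t *ᶻ χ p *ᶻ ω p ^ᶻ M

L-sum-of-pairs : ∀ M → ∑[ i < 4 ] (L (suc M) (ζ ^ᶻ toℕ i) +ᶻ L (suc M) (-ᶻ ζ ^ᶻ toℕ i)) ≡ fromℕ (suc M) *ᶻ (fromℕ 2 *ᶻ σ (suc M))
L-sum-of-pairs M = begin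
  ∑[ i < 4 ] (L (suc M) (ρ i) +ᶻ L (suc M) (-ᶻ ρ i))   ≡⟨ sum-cong-≗ {4} {y = λ i → n *ᶻ (ρ i *ᶻ ∑□ (G i))}
                                                            (λ i → trans (L-pair M i) (*ᶻ-assoc n (ρ i) (∑□ (G i)))) ⟩
  ∑[ i < 4 ] (n *ᶻ (ρ i *ᶻ ∑□ (G i)))                  ≡⟨ sym (*-distribˡ-sum n (λ i → ρ i *ᶻ ∑□ (G i))) ⟩
  n *ᶻ ∑[ i < 4 ] (ρ i *ᶻ ∑□ (G i))                    ≡⟨ cong (n *ᶻ_) (sum-cong-≗ {4} {y = λ i → ∑□ (λ p → ρ i *ᶻ G i p)} (λ i → ∑□-*ˡ (ρ i) (G i))) ⟩
  n *ᶻ ∑[ i < 4 ] ∑□ (λ p → ρ i *ᶻ G i p)              ≡⟨ cong (n *ᶻ_) (sym (∑□-∑ (λ i p → ρ i *ᶻ G i p))) ⟩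
  n *ᶻ ∑□ (λ p → ∑[ i < 4 ] (ρ i *ᶻ G i p))            ≡⟨ cong (n *ᶻ_) (∑□-cong pointwise) ⟩
  n *ᶻ ∑□ (λ p → fromℕ 2 *ᶻ (χ p *ᶻ ω p ^ᶻ suc M))     ≡⟨ cong (n *ᶻ_) (sym (∑□-*ˡ (fromℕ 2) (λ p → χ p *ᶻ ω p ^ᶻ suc M))) ⟩
  n *ᶻ (fromℕ 2 *ᶻ σ (suc M))                         ∎
  where
  n = fromℕ (suc M)
  ρ : Fin 4 → ℚ[ζ]
  ρ i = ζ ^ᶻ toℕ i
  G : Fin 4 → Point → ℚ[ζ]
  G i p = sign (coord i p) *ᶻ χ p *ᶻ ω p ^ᶻ M
  pointwise : ∀ p → ∑[ i < 4 ] (ρ i *ᶻ G i p) ≡ fromℕ 2 *ᶻ (χ p *ᶻ ω p ^ᶻ suc M)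
  pointwise p = begin
    ∑[ i < 4 ] (ρ i *ᶻ G i p)                                   ≡⟨ sum-cong-≗ {4} {y = λ i → ρ i *ᶻ sign (coord i p) *ᶻ h}
                                                                     (λ i → regroup (ρ i) (sign (coord i p)) (χ p) (ω p ^ᶻ M)) ⟩
    ∑[ i < 4 ] (ρ i *ᶻ sign (coord i p) *ᶻ h)                   ≡⟨ sym (*-distribʳ-sum h (λ i → ρ i *ᶻ sign (coord i p))) ⟩
    ∑[ i < 4 ] (ρ i *ᶻ sign (coord i p)) *ᶻ h                   ≡⟨ cong (_*ᶻ h) (ω-from-coords p) ⟩
    fromℕ 2 *ᶻ ω p *ᶻ h                                         ≡⟨ regroup′ (fromℕ 2) (ω p) (χ p) (ω p ^ᶻ M) ⟩
    fromℕ 2 *ᶻ (χ p *ᶻ ω p ^ᶻ suc M)                            ∎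
    where
    h = χ p *ᶻ ω p ^ᶻ M
    regroup : ∀ r s c w → r *ᶻ (s *ᶻ c *ᶻ w) ≡ r *ᶻ s *ᶻ (c *ᶻ w)
    regroup = solve-∀ ℚ[ζ]-ring
    regroup′ : ∀ t x c w → t *ᶻ x *ᶻ (c *ᶻ w) ≡ t *ᶻ (c *ᶻ (x *ᶻ w))
    regroup′ = solve-∀ ℚ[ζ]-ring

ζ^k-root : ∀ k → (ζ ^ᶻ k) ^ᶻ 8 ≡ 1ᶻ
ζ^k-root k = begin
  (ζ ^ᶻ k) ^ᶻ 8    ≡⟨ ^-assocʳ ζ k 8 ⟩
  ζ ^ᶻ (k * 8)     ≡⟨ cong (ζ ^ᶻ_) (ℕ.*-comm k 8) ⟩
  ζ ^ᶻ (8 * k)     ≡⟨ ζ^[8q]≡1 k ⟩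
  1ᶻ               ∎

-root : ∀ {x} → x ^ᶻ 8 ≡ 1ᶻ → (-ᶻ x) ^ᶻ 8 ≡ 1ᶻ
-root {x} x⁸≡1 = begin
  (-ᶻ x) ^ᶻ 8           ≡⟨ sym (^-assocʳ (-ᶻ x) 2 4) ⟩
  ((-ᶻ x) ^ᶻ 2) ^ᶻ 4    ≡⟨ cong (_^ᶻ 4) (square-neg x) ⟩
  (x ^ᶻ 2) ^ᶻ 4         ≡⟨ ^-assocʳ x 2 4 ⟩
  x ^ᶻ 8                ≡⟨ x⁸≡1 ⟩
  1ᶻ                    ∎
  where
  square-neg : ∀ y → (-ᶻ y) *ᶻ ((-ᶻ y) *ᶻ 1ᶻ) ≡ y *ᶻ (y *ᶻ 1ᶻ)
  square-neg = solve-∀ ℚ[ζ]-ring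

8T≡2Nσ : ∀ n → fromℕ 8 *ᶻ T n ≡ fromℕ (8 * n + 4) *ᶻ (fromℕ 2 *ᶻ σ (8 * n + 4))
8T≡2Nσ n = begin
  fromℕ 8 *ᶻ T n                                        ≡⟨ eight (T n) ⟩
  ∑[ i < 4 ] (T n +ᶻ T n)                               ≡⟨ sum-cong-≗ {4} {y = λ i → L N (ζ ^ᶻ toℕ i) +ᶻ L N (-ᶻ ζ ^ᶻ toℕ i)} (λ i →
                                                             sym (cong₂ _+ᶻ_ (L-collapse n (ζ^k-root (toℕ i))) (L-collapse n (-root (ζ^k-root (toℕ i)))))) ⟩
  ∑[ i < 4 ] (L N (ζ ^ᶻ toℕ i) +ᶻ L N (-ᶻ ζ ^ᶻ toℕ i))  ≡⟨ subst (λ K → ∑[ i < 4 ] (L K (ζ ^ᶻ toℕ i) +ᶻ L K (-ᶻ ζ ^ᶻ toℕ i)) ≡ fromℕ K *ᶻ (fromℕ 2 *ᶻ σ K))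
                                                             (sym (ℕ.+-suc (8 * n) 3)) (L-sum-of-pairs (8 * n + 3)) ⟩
  fromℕ N *ᶻ (fromℕ 2 *ᶻ σ N)                           ∎
  where
  N = 8 * n + 4
  eight : ∀ t → fromℕ 8 *ᶻ t ≡ t +ᶻ t +ᶻ (t +ᶻ t +ᶻ (t +ᶻ t +ᶻ (t +ᶻ t +ᶻ 0ᶻ)))
  eight = solve-∀ ℚ[ζ]-ring

*ᶻ-cancelˡ : ∀ {u x y z} → u *ᶻ x ≡ 1ᶻ → x *ᶻ y ≡ x *ᶻ z → y ≡ z
*ᶻ-cancelˡ {u} {x} {y} {z} ux≡1 xy≡xz = begin
  y                ≡⟨ sym (*ᶻ-identityˡ y) ⟩
  1ᶻ *ᶻ y          ≡⟨ cong (_*ᶻ y) (sym ux≡1) ⟩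
  u *ᶻ x *ᶻ y      ≡⟨ *ᶻ-assoc u x y ⟩
  u *ᶻ (x *ᶻ y)    ≡⟨ cong (u *ᶻ_) xy≡xz ⟩
  u *ᶻ (x *ᶻ z)    ≡⟨ sym (*ᶻ-assoc u x z) ⟩
  u *ᶻ x *ᶻ z      ≡⟨ cong (_*ᶻ z) ux≡1 ⟩
  1ᶻ *ᶻ z          ≡⟨ *ᶻ-identityˡ z ⟩
  z                ∎

signedA : ℕ → ℚ[ζ]
signedA k = (-ᶻ 1ᶻ) ^ᶻ k *ᶻ A (4 * k + 2)

T≡8κ*Σ : ∀ n → T n ≡ fromℕ 8 *ᶻ κ *ᶻ Σ (suc n) (λ k → γ n k *ᶻ signedA k)
T≡8κ*Σ n = sym (trans (Σ-*ˡ (suc n) 8κ (λ k → γ n k *ᶻ signedA k)) (Σ-cong (suc n) λ k _ →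
  trans (x∙yz≈y∙xz 8κ (γ n k) (signedA k)) (cong (γ n k *ᶻ_) (trans (*ᶻ-assoc (fromℕ 8) κ (signedA k)) (sym (σ-8q+4 k))))))
  where 8κ = fromℕ 8 *ᶻ κ

identity-in-ℚ[ζ] : ∀ n → Σ (suc n) (λ k → γ n k *ᶻ signedA k) ≡ fromℕ (2 * n + 1) *ᶻ signedA n
-- 64κ = −64ζ² has inverse ζ²/64.
identity-in-ℚ[ζ] n = *ᶻ-cancelˡ {u = mk 0ℚ 0ℚ (+ 1 ℚ./ 64) 0ℚ} refl (begin
  fromℕ 8 *ᶻ 8κ *ᶻ Σ (suc n) (λ k → γ n k *ᶻ signedA k)         ≡⟨ *ᶻ-assoc (fromℕ 8) 8κ _ ⟩
  fromℕ 8 *ᶻ (8κ *ᶻ Σ (suc n) (λ k → γ n k *ᶻ signedA k))       ≡⟨ cong (fromℕ 8 *ᶻ_) (sym (T≡8κ*Σ n)) ⟩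
  fromℕ 8 *ᶻ T n                                                ≡⟨ 8T≡2Nσ n ⟩
  fromℕ (8 * n + 4) *ᶻ (fromℕ 2 *ᶻ σ (8 * n + 4))               ≡⟨ cong₂ (λ m s → m *ᶻ (fromℕ 2 *ᶻ s)) N≡4[2n+1] σ-top ⟩
  fromℕ 4 *ᶻ fromℕ (2 * n + 1) *ᶻ (fromℕ 2 *ᶻ (8κ *ᶻ signedA n)) ≡⟨ regroup (fromℕ 4) (fromℕ (2 * n + 1)) (fromℕ 2) 8κ (signedA n) ⟩
  fromℕ 4 *ᶻ fromℕ 2 *ᶻ 8κ *ᶻ (fromℕ (2 * n + 1) *ᶻ signedA n)   ≡⟨⟩
  fromℕ 8 *ᶻ 8κ *ᶻ (fromℕ (2 * n + 1) *ᶻ signedA n)             ∎)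
  where
  8κ = fromℕ 8 *ᶻ κ
  N≡4[2n+1] : fromℕ (8 * n + 4) ≡ fromℕ 4 *ᶻ fromℕ (2 * n + 1)
  N≡4[2n+1] = trans (cong fromℕ (solved n)) (fromℕ-* 4 (2 * n + 1))
    where
    solved : ∀ m → 8 * m + 4 ≡ 4 * (2 * m + 1)
    solved = ℕ-solve-∀
  σ-top : σ (8 * n + 4) ≡ 8κ *ᶻ signedA n
  σ-top = trans (cong (λ m → σ (m + 4)) (ℕ.*-comm 8 n)) (trans (σ-8q+4 n) (sym (*ᶻ-assoc (fromℕ 8) κ (signedA n))))
  regroup : ∀ a m b k s → a *ᶻ m *ᶻ (b *ᶻ (k *ᶻ s)) ≡ a *ᶻ b *ᶻ k *ᶻ (m *ᶻ s)
  regroup = solve-∀ ℚ[ζ]-ring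

φ : ℚ√2 → ℚ[ζ]
φ (p + q √2) = mk p q 0ℚ (ℚ.- q)

φ-injective : ∀ {x y} → φ x ≡ φ y → x ≡ y
φ-injective {p + q √2} {p′ + q′ √2} refl = refl

φ-⊕ : ∀ x y → φ (x ⊕ y) ≡ φ x +ᶻ φ y
φ-⊕ (p + q √2) (p′ + q′ √2) = mk-cong refl refl refl (ℚ.neg-distrib-+ q q′)

φ-⊗ : ∀ x y → φ (x ⊗ y) ≡ φ x *ᶻ φ y
φ-⊗ (p + q √2) (p′ + q′ √2) = mk-cong (c₀ p q p′ q′) (c₁ p q p′ q′) (c₂ p q p′ q′) (c₃ p q p′ q′)
  where
  c₀ : ∀ p q p′ q′ → p ℚ.* p′ ℚ.+ ℕtoℚ 2 ℚ.* (q ℚ.* q′) ≡ p ℚ.* p′ ℚ.- q ℚ.* (ℚ.- q′) ℚ.- 0ℚ ℚ.* 0ℚ ℚ.- (ℚ.- q) ℚ.* q′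
  c₀ = solve-∀ ℚ-ring
  c₁ : ∀ p q p′ q′ → p ℚ.* q′ ℚ.+ q ℚ.* p′ ≡ p ℚ.* q′ ℚ.+ q ℚ.* p′ ℚ.- 0ℚ ℚ.* (ℚ.- q′) ℚ.- (ℚ.- q) ℚ.* 0ℚ
  c₁ = solve-∀ ℚ-ring
  c₂ : ∀ p q p′ q′ → 0ℚ ≡ p ℚ.* 0ℚ ℚ.+ q ℚ.* q′ ℚ.+ 0ℚ ℚ.* p′ ℚ.- (ℚ.- q) ℚ.* (ℚ.- q′)
  c₂ = solve-∀ ℚ-ring
  c₃ : ∀ p q p′ q′ → ℚ.- (p ℚ.* q′ ℚ.+ q ℚ.* p′) ≡ p ℚ.* (ℚ.- q′) ℚ.+ q ℚ.* 0ℚ ℚ.+ 0ℚ ℚ.* q′ ℚ.+ (ℚ.- q) ℚ.* p′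
  c₃ = solve-∀ ℚ-ring

φ-^ : ∀ x m → φ (x ^√2 m) ≡ φ x ^ᶻ m
φ-^ x zero    = refl
φ-^ x (suc m) = trans (φ-⊗ x (x ^√2 m)) (cong (φ x *ᶻ_) (φ-^ x m))

φ-a : ∀ m → φ (a m) ≡ A m
φ-a m = trans (φ-⊕ ((ι 1ℚ ⊕ inv√2) ^√2 m) ((ι 1ℚ ⊕ neg inv√2) ^√2 m)) (cong₂ _+ᶻ_ (φ-^ (ι 1ℚ ⊕ inv√2) m) (φ-^ (ι 1ℚ ⊕ neg inv√2) m))

φ-Σ√0to : ∀ n f → φ (Σ√0to n f) ≡ Σ (suc n) (φ ∘ f)
φ-Σ√0to n f = Σ-foldr _⊕_ (ι 0ℚ) φ refl φ-⊕ (suc n) f (λ i → i)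

fromℚ-sgn : ∀ k → fromℚ (sgn k) ≡ (-ᶻ 1ᶻ) ^ᶻ k
fromℚ-sgn zero    = refl
fromℚ-sgn (suc k) = trans (cong -ᶻ_ (fromℚ-sgn k)) (-ᶻ-as-* ((-ᶻ 1ᶻ) ^ᶻ k))

fromℚ-sgn-+1 : ∀ k → fromℚ (sgn (k + 1)) ≡ -ᶻ ((-ᶻ 1ᶻ) ^ᶻ k)
fromℚ-sgn-+1 k = trans (cong (fromℚ ∘ sgn) (ℕ.+-comm k 1)) (cong -ᶻ_ (fromℚ-sgn k))

φ-summand : ∀ k c m b → φ (ι (sgn (k + 1)) ⊗ ι (ℕtoℚ c) ⊗ a m ⊗ ι (B b))
                        ≡ (-ᶻ 1ᶻ) *ᶻ (fromℕ c *ᶻ B̂ b *ᶻ ((-ᶻ 1ᶻ) ^ᶻ k *ᶻ A m))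
φ-summand k c m b = begin
  φ (ι (sgn (k + 1)) ⊗ ι (ℕtoℚ c) ⊗ a m ⊗ ι (B b))
    ≡⟨ trans (φ-⊗ (ι (sgn (k + 1)) ⊗ ι (ℕtoℚ c) ⊗ a m) (ι (B b))) (cong (_*ᶻ B̂ b) (trans (φ-⊗ (ι (sgn (k + 1)) ⊗ ι (ℕtoℚ c)) (a m)) (cong₂ _*ᶻ_ (φ-⊗ (ι (sgn (k + 1))) (ι (ℕtoℚ c))) (φ-a m)))) ⟩
  fromℚ (sgn (k + 1)) *ᶻ fromℚ (ℕtoℚ c) *ᶻ A m *ᶻ B̂ b
    ≡⟨ cong₂ (λ s n → s *ᶻ n *ᶻ A m *ᶻ B̂ b) (fromℚ-sgn-+1 k) (fromℚ-ℕtoℚ c) ⟩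
  -ᶻ ((-ᶻ 1ᶻ) ^ᶻ k) *ᶻ fromℕ c *ᶻ A m *ᶻ B̂ b
    ≡⟨ reorder ((-ᶻ 1ᶻ) ^ᶻ k) (fromℕ c) (A m) (B̂ b) ⟩
  (-ᶻ 1ᶻ) *ᶻ (fromℕ c *ᶻ B̂ b *ᶻ ((-ᶻ 1ᶻ) ^ᶻ k *ᶻ A m))
    ∎
  where
  reorder : ∀ s n x y → -ᶻ s *ᶻ n *ᶻ x *ᶻ y ≡ (-ᶻ 1ᶻ) *ᶻ (n *ᶻ y *ᶻ (s *ᶻ x))
  reorder = solve-∀ ℚ[ζ]-ring

φ-right-side : ∀ c k m → φ (ι (ℕtoℚ c) ⊗ ι (sgn (k + 1)) ⊗ a m) ≡ (-ᶻ 1ᶻ) *ᶻ (fromℕ c *ᶻ ((-ᶻ 1ᶻ) ^ᶻ k *ᶻ A m))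
φ-right-side c k m = begin
  φ (ι (ℕtoℚ c) ⊗ ι (sgn (k + 1)) ⊗ a m)
    ≡⟨ trans (φ-⊗ (ι (ℕtoℚ c) ⊗ ι (sgn (k + 1))) (a m)) (cong₂ _*ᶻ_ (φ-⊗ (ι (ℕtoℚ c)) (ι (sgn (k + 1)))) (φ-a m)) ⟩
  fromℚ (ℕtoℚ c) *ᶻ fromℚ (sgn (k + 1)) *ᶻ A m
    ≡⟨ cong₂ (λ n s → n *ᶻ s *ᶻ A m) (fromℚ-ℕtoℚ c) (fromℚ-sgn-+1 k) ⟩
  fromℕ c *ᶻ -ᶻ ((-ᶻ 1ᶻ) ^ᶻ k) *ᶻ A m
    ≡⟨ reorder (fromℕ c) ((-ᶻ 1ᶻ) ^ᶻ k) (A m) ⟩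
  (-ᶻ 1ᶻ) *ᶻ (fromℕ c *ᶻ ((-ᶻ 1ᶻ) ^ᶻ k *ᶻ A m))
    ∎
  where
  reorder : ∀ n s x → n *ᶻ -ᶻ s *ᶻ x ≡ (-ᶻ 1ᶻ) *ᶻ (n *ᶻ (s *ᶻ x))
  reorder = solve-∀ ℚ[ζ]-ring

mainTheorem4 : (n : ℕ) →
    Σ√0to n (λ k → ι (sgn (k + 1)) ⊗ ι (ℕtoℚ ((8 * n + 4) C (8 * k + 4))) ⊗ a (4 * k + 2) ⊗ ι (B (8 * n ∸ 8 * k)))
      ≡ ι (ℕtoℚ (2 * n + 1)) ⊗ ι (sgn (n + 1)) ⊗ a (4 * n + 2)
mainTheorem4 n = φ-injective (begin
  φ (Σ√0to n summand)                                        ≡⟨ φ-Σ√0to n summand ⟩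
  Σ (suc n) (φ ∘ summand)                                    ≡⟨ Σ-cong (suc n) (λ k _ →
                                                                  φ-summand k ((8 * n + 4) C (8 * k + 4)) (4 * k + 2) (8 * n ∸ 8 * k)) ⟩
  Σ (suc n) (λ k → (-ᶻ 1ᶻ) *ᶻ term k)                        ≡⟨ sym (Σ-*ˡ (suc n) (-ᶻ 1ᶻ) term) ⟩
  (-ᶻ 1ᶻ) *ᶻ Σ (suc n) term                                  ≡⟨ cong ((-ᶻ 1ᶻ) *ᶻ_) (identity-in-ℚ[ζ] n) ⟩
  (-ᶻ 1ᶻ) *ᶻ (fromℕ (2 * n + 1) *ᶻ signedA n)                ≡⟨ sym (φ-right-side (2 * n + 1) n (4 * n + 2)) ⟩
  φ (ι (ℕtoℚ (2 * n + 1)) ⊗ ι (sgn (n + 1)) ⊗ a (4 * n + 2)) ∎)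
  where
  summand : ℕ → ℚ√2
  summand k = ι (sgn (k + 1)) ⊗ ι (ℕtoℚ ((8 * n + 4) C (8 * k + 4))) ⊗ a (4 * k + 2) ⊗ ι (B (8 * n ∸ 8 * k))
  term : ℕ → ℚ[ζ]
  term k = γ n k *ᶻ signedA k
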